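{- Let $n, m \ge 1$ be integers, let $S \subseteq S_n$ be a set of permutations containing the identity, and let $G \le S_n$ be the subgroup generated by $S$. The player can win the $(S, m)$-game if and only if $|G| = 1$, or $m = 1$, or $(|G|, m) = (p^a, p^b)$ for some prime $p$ and some positive integers $a, b$.
   Context: The $(S,m)$-game: $n$ counters lie at positions $1, \dots, n$, each showing an element of $\mathbb{Z}_m$; the initial configuration $(x_1,\dots,x_n) \in \mathbb{Z}_m^n$ is arbitrary and unknown to the player (who is blindfolded and receives no information). Each turn the player makes a move $y = (y_1, \dots, y_n) \in \mathbb{Z}_m^n$, adding $y_i$ to the counter currently at position $i$ for every $i$; afterwards the counters are permuted by an arbitrary permutation $g \in S$ (chosen adversarially), the counter at position $x$ moving to position $g(x)$. A strategy is therefore a fixed finite sequence of moves $y_1, \dots, y_N$. The player "can win" if there is such a finite sequence such that, for every initial configuration and every choice of the permutations from $S$, at some point (initially or after some move) all $n$ counters simultaneously show $0$. -}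

module Defs where

open import Data.Nat using (ℕ; zero; suc; _+_; _^_; _≤_; NonZero)
open import Data.Nat.DivMod using (_mod_)
open import Data.Nat.Primality using (Prime)
open import Data.Fin using (Fin; toℕ)
open import Data.Fin.Permutation using (Permutation′; _⟨$⟩ʳ_; _⟨$⟩ˡ_)
open import Data.Vec using (Vec; tabulate; lookup)
open import Data.List using (List; []; _∷_)
open import Data.List.Membership.Propositional using (_∈_)
open import Data.List.Relation.Unary.Any using (Any)
open import Data.List.Relation.Unary.Unique.Propositional using (Unique)
open import Data.Product using (Σ; ∃; _×_)
open import Data.Sum using (_⊎_)
open import Function using (_∘_; _⇔_)
open import Relation.Binary.PropositionalEquality using (_≡_)

ℤ_ : (m : ℕ) → Set
ℤ_ m = Fin m

module _ (m : ℕ) .{{_ : NonZero m}} where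

  0ₘ : ℤ_ m
  0ₘ = 0 mod m

  _+ₘ_ : ℤ_ m → ℤ_ m → ℤ_ m
  a +ₘ b = (toℕ a + toℕ b) mod m

-- A configuration: the value shown by the counter currently at each position.
Config : ℕ → (m : ℕ) → Set
Config n m = Fin n → ℤ_ m

Move : ℕ → (m : ℕ) → Set
Move n m = Fin n → ℤ_ m

-- One turn: apply the move y, then permute by g (counter at position x goes to g x),
-- so the counter now at position j is the one that was at g⁻¹ j.
step : ∀ {n} (m : ℕ) .{{_ : NonZero m}} → Config n m → Move n m → Permutation′ n → Config n m
step m c y g j = _+ₘ_ m (c (g ⟨$⟩ˡ j)) (y (g ⟨$⟩ˡ j))

Adversary : ∀ {n} → List (Permutation′ n) → Set
Adversary {n} S = ℕ → Σ (Permutation′ n) (λ g → g ∈ S)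

configs : ∀ {n} (m : ℕ) .{{_ : NonZero m}} (S : List (Permutation′ n)) →
          Config n m → List (Move n m) → Adversary S → List (Config n m)
configs m S c [] adv = c ∷ []
configs m S c (y ∷ ys) adv =
  c ∷ configs m S (step m c y (Σ.proj₁ (adv 0))) ys (adv ∘ suc)

AllZero : ∀ {n} (m : ℕ) .{{_ : NonZero m}} → Config n m → Set
AllZero m c = ∀ i → c i ≡ 0ₘ m

CanWin : ∀ {n} (S : List (Permutation′ n)) (m : ℕ) .{{_ : NonZero m}} → Set
CanWin {n} S m =
  ∃ λ (ys : List (Move n m)) →
    ∀ (x : Config n m) (adv : Adversary S) → Any (AllZero m) (configs m S x ys adv)

-- Elements of the subgroup G = ⟨S⟩ ≤ S_n, each represented by its table of values
-- (so that equality of group elements is propositional equality of vectors).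
table : ∀ {n} → Permutation′ n → Vec (Fin n) n
table g = tabulate (g ⟨$⟩ʳ_)

data InGen {n} (S : List (Permutation′ n)) : Vec (Fin n) n → Set where
  gen-id  : InGen S (tabulate (λ i → i))
  gen-mul : ∀ {v} g → g ∈ S → InGen S v → InGen S (tabulate (λ i → g ⟨$⟩ʳ lookup v i))
  gen-inv : ∀ {v} g → g ∈ S → InGen S v → InGen S (tabulate (λ i → g ⟨$⟩ˡ lookup v i))

GroupOrder : ∀ {n} → List (Permutation′ n) → ℕ → Set
GroupOrder {n} S k =
  Σ (List (Vec (Fin n) n)) λ L →
    Unique L × Data.List.length L ≡ k × (∀ v → (v ∈ L) ⇔ InGen S v)
  where import Data.List

IsIdentity : ∀ {n} → Permutation′ n → Set
IsIdentity g = ∀ i → g ⟨$⟩ʳ i ≡ i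

WinCondition : ℕ → ℕ → Set
WinCondition k m =
  k ≡ 1 ⊎ m ≡ 1 ⊎
  (∃ λ p → ∃ λ a → ∃ λ b → Prime p × 1 ≤ a × 1 ≤ b × k ≡ p ^ a × m ≡ p ^ b)

-- Let V₀ = 0 and V_{j+1} = {v ∈ ℤₘⁿ | v ∘ s − v ∈ V_j for all s ∈ S} (Layer j below); each V_j
-- is a G-invariant subgroup. The player wins iff V_N = ℤₘⁿ for some N. If so, a winning sequence
-- for V_{j+1} runs, for every w ∈ V_{j+1}, the block −w, (sequence for V_j), +w: on V_{j+1} the
-- permutations are invisible modulo V_j, so each block keeps the class of the configuration
-- modulo V_j, and the block for w in that class drops it into V_j. Conversely, since the identity
-- is in S, every configuration outside V_{j+1} has, for each move, a predecessor outside V_j, so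
-- some start stays nonzero throughout N moves unless V_N = ℤₘⁿ.
--
-- If |G| = pᵃ and m = pᵇ, the p-group G acts on the p-power many classes of ℤₘⁿ / V_j fixing that
-- of 0, so it fixes another class unless V_j = ℤₘⁿ; a fixed class lies in V_{j+1}, so the chain
-- grows until it is full. Conversely, if a prime r ≠ p divides |G| for a prime p ∣ m, Cauchy's
-- theorem gives g ∈ G of order r. The chain is then also full over ℤ_p, so D = g − 1 is nilpotent
-- on ℤ_pⁿ; but D²u = 0 forces r · Du = 0 (sum Du over a g-orbit) and hence Du = 0, since r is
-- invertible mod p. So D = 0, contradicting g ≠ 1.

{-# OPTIONS --safe #-}
module Submission where

open import Level using (0ℓ)
open import Algebra.Bundles using (AbelianGroup)
import Algebra.Construct.Pointwise as Pointwise
import Algebra.Definitions.RawMonoid as RawMonoidDefinitions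
import Algebra.Properties.AbelianGroup as AbelianGroupProperties
import Algebra.Properties.CommutativeSemigroup as CommutativeSemigroupProperties
open import Data.Empty using (⊥; ⊥-elim)
open import Data.Fin using (Fin; toℕ; fromℕ<)
import Data.Fin.Properties as Fin
open import Data.Fin.Properties using (toℕ-injective; toℕ<n; toℕ-fromℕ<; ¬∀⟶∃¬)
open import Data.Fin.Permutation using (Permutation′; _⟨$⟩ʳ_; _⟨$⟩ˡ_)
import Data.Fin.Permutation as Perm
open import Data.List
  using (List; []; _∷_; _++_; [_]; length; map; foldr; filter; concatMap; allFin; replicate
         ; cartesianProduct; cartesianProductWith)
open import Data.List.Membership.Propositional using (_∈_; find; lose)
open import Data.List.Membership.Propositional.Properties
  using (∈-cartesianProductWith⁺; ∈-cartesianProductWith⁻; ∈-cartesianProduct⁺; ∈-cartesianProduct⁻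
         ; ∈-filter⁺; ∈-filter⁻; ∈-map⁺; ∈-map⁻; ∈-allFin)
import Data.List.Properties as List
open import Data.List.Properties
  using (length-++; length-map; length-filter; length-tabulate; length-replicate; length-removeAt′
         ; filter-accept; filter-reject; filter-all; filter-notAll; ++-assoc; ++-identityʳ
         ; ∷-injective; ∷-injectiveʳ)
open import Data.List.Relation.Unary.All as All using (All; []; _∷_; all?)
import Data.List.Relation.Unary.All.Properties as All
open import Data.List.Relation.Unary.All.Properties using (¬All⇒Any¬; All¬⇒¬Any)
open import Data.List.Relation.Unary.Any as Any using (Any; here; there; any?; index; _─_)
open import Data.List.Relation.Unary.Unique.Propositional using (Unique; []; _∷_)
import Data.List.Relation.Unary.Unique.Propositional.Properties as Unique
open import Data.Nat
  using (ℕ; zero; suc; _+_; _*_; _∸_; _^_; _%_; _/_; _≤_; _<_; z≤n; s≤s; NonZero; ≢-nonZero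
         ; ≢-nonZero⁻¹; nonTrivial⇒n>1)
import Data.Nat as ℕ
open import Data.Nat.DivMod
  using (_mod_; %-distribˡ-+; m%n%n≡m%n; m<n⇒m%n≡m; n%n≡0; m*n%n≡0; m∣n⇒o%n%m≡o%m; m≡m%n+[m/n]*n)
open import Data.Nat.Divisibility
  using (_∣_; divides; ∣-trans; ∣1⇒≡1; 0∣⇒≡0; m∣m*n; n∣m*n; ∣⇒≤; ∣m+n∣m⇒∣n; m%n≡0⇒n∣m; n∣m⇒m%n≡0)
open import Data.Nat.GeneralisedArithmetic using (iterate; fold)
open import Data.Nat.ListAction using (product)
open import Data.Nat.Primality
  using (Prime; euclidsLemma; prime⇒irreducible; ¬prime[1]; prime⇒nonZero; prime⇒nonTrivial)
open import Data.Nat.Primality.Factorisation using (factorise)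
open import Data.Nat.Properties
  using (+-comm; +-assoc; +-suc; +-identityʳ; *-comm; *-identityʳ; ^-*-assoc; m^n≢0; m+[n∸m]≡n; <⇒≤
         ; ≤-refl; ≤-trans; ≤-antisym; ≤-pred; ≤-<-trans; <-≤-trans; <-irrefl; m≤n⇒m≤1+n
         ; suc-injective; n<1⇒n≡0)
open import Data.Product using (Σ; ∃; _×_; _,_; proj₁; proj₂)
open import Data.Product.Properties using (,-injectiveˡ; ,-injectiveʳ)
open import Data.Sum using (_⊎_; inj₁; inj₂)
open import Data.Vec using (Vec; []; _∷_; lookup; tabulate)
import Data.Vec.Properties as Vec
open import Data.Vec.Properties using (lookup∘tabulate; tabulate∘lookup; tabulate-cong)
import Data.Vec.Relation.Unary.All as VecAll
import Data.Vec.Relation.Unary.All.Properties as VecAll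
open import Function using (_∘_; _⇔_; mk⇔; Equivalence)
open import Relation.Binary using (DecidableEquality)
open import Relation.Binary.Bundles using (Setoid)
open import Relation.Binary.PropositionalEquality
  using (_≡_; _≢_; refl; sym; trans; cong; cong₂; subst; module ≡-Reasoning)
open import Relation.Binary.PropositionalEquality.Algebra using (isMagma)
import Relation.Binary.Reasoning.Setoid as SetoidReasoning
open import Relation.Nullary using (Dec; yes; no; ¬_; ¬?; contradiction)
open import Relation.Nullary.Decidable using (_×-dec_; decidable-stable)
open import Relation.Unary using (Decidable)
open import Defs

module AbelianGroupLemmas {a ℓ} (G : AbelianGroup a ℓ) where

  open AbelianGroup G hiding (refl; sym; trans)
  open AbelianGroupProperties G
  open CommutativeSemigroupProperties commutativeSemigroup using (interchange)
  open SetoidReasoning setoid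

  -‿trans : ∀ x y z → (x - y) ∙ (y - z) ≈ x - z
  -‿trans x y z = begin
    (x - y) ∙ (y - z)      ≈⟨ assoc (x - y) y (z ⁻¹) ⟨
    ((x - y) ∙ y) ∙ z ⁻¹   ≈⟨ ∙-congʳ (//-rightDividesˡ y x) ⟩
    x - z                  ∎

  -‿identityʳ : ∀ x → x - ε ≈ x
  -‿identityʳ x = begin
    x ∙ ε ⁻¹   ≈⟨ ∙-congˡ ε⁻¹≈ε ⟩
    x ∙ ε      ≈⟨ identityʳ x ⟩
    x          ∎

  -‿interchange : ∀ x y u v → (x ∙ y) - (u ∙ v) ≈ (x - u) ∙ (y - v)
  -‿interchange x y u v = begin
    (x ∙ y) ∙ (u ∙ v) ⁻¹       ≈⟨ ∙-congˡ (⁻¹-∙-comm u v) ⟨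
    (x ∙ y) ∙ (u ⁻¹ ∙ v ⁻¹)    ≈⟨ interchange x y (u ⁻¹) (v ⁻¹) ⟩
    (x - u) ∙ (y - v)          ∎

  -‿cancelʳ : ∀ x y z → (x ∙ z) - (y ∙ z) ≈ x - y
  -‿cancelʳ x y z = begin
    (x ∙ z) - (y ∙ z)      ≈⟨ -‿interchange x z y z ⟩
    (x - y) ∙ (z - z)      ≈⟨ ∙-congˡ (inverseʳ z) ⟩
    (x - y) ∙ ε            ≈⟨ identityʳ (x - y) ⟩
    x - y                  ∎

  xy-x≈y : ∀ x y → (x ∙ y) - x ≈ y
  xy-x≈y x y = begin
    (x ∙ y) - x    ≈⟨ ∙-congʳ (comm x y) ⟩
    (y ∙ x) - x    ≈⟨ //-rightDividesʳ x y ⟩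
    y              ∎

  ∙-≈⇒-‿≈ : ∀ x y u v → x ∙ y ≈ u ∙ v → x - u ≈ v - y
  ∙-≈⇒-‿≈ x y u v eq = begin
    x - u                    ≈⟨ -‿cancelʳ x u y ⟨
    (x ∙ y) - (u ∙ y)        ≈⟨ ∙-congʳ eq ⟩
    (u ∙ v) - (u ∙ y)        ≈⟨ ∙-congʳ (comm u v) ⟩
    (v ∙ u) - (u ∙ y)        ≈⟨ ∙-congˡ (⁻¹-cong (comm u y)) ⟩
    (v ∙ u) - (y ∙ u)        ≈⟨ -‿cancelʳ v y u ⟩
    v - y                    ∎

module ℤₘ (m : ℕ) .{{_ : NonZero m}} where

  toℕ-mod : ∀ x → toℕ (x mod m) ≡ x % m
  toℕ-mod x = toℕ-fromℕ< _

  mod-cong : ∀ {x y} → x % m ≡ y % m → x mod m ≡ y mod m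
  mod-cong {x} {y} e = toℕ-injective (trans (toℕ-mod x) (trans e (sym (toℕ-mod y))))

  toℕ-mod-toℕ : ∀ (a : ℤ_ m) → toℕ a mod m ≡ a
  toℕ-mod-toℕ a = toℕ-injective (trans (toℕ-mod (toℕ a)) (m<n⇒m%n≡m (toℕ<n a)))

  %-absorbˡ : ∀ x y → (x % m + y) % m ≡ (x + y) % m
  %-absorbˡ x y = begin
    (x % m + y) % m            ≡⟨ %-distribˡ-+ (x % m) y m ⟩
    (x % m % m + y % m) % m    ≡⟨ cong (λ t → (t + y % m) % m) (m%n%n≡m%n x m) ⟩
    (x % m + y % m) % m        ≡⟨ %-distribˡ-+ x y m ⟨
    (x + y) % m                ∎
    where open ≡-Reasoning

  %-absorbʳ : ∀ x y → (x + y % m) % m ≡ (x + y) % m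
  %-absorbʳ x y = trans (cong (_% m) (+-comm x (y % m)))
                        (trans (%-absorbˡ y x) (cong (_% m) (+-comm y x)))

  toℕ-0ₘ : toℕ (0ₘ m) ≡ 0
  toℕ-0ₘ = trans (toℕ-mod 0) (m*n%n≡0 0 m)

  -ₘ_ : ℤ_ m → ℤ_ m
  -ₘ a = (m ∸ toℕ a) mod m

  +ₘ-comm : ∀ a b → _+ₘ_ m a b ≡ _+ₘ_ m b a
  +ₘ-comm a b = cong (_mod m) (+-comm (toℕ a) (toℕ b))

  +ₘ-assoc : ∀ a b c → _+ₘ_ m (_+ₘ_ m a b) c ≡ _+ₘ_ m a (_+ₘ_ m b c)
  +ₘ-assoc a b c = mod-cong (begin
    (toℕ ((toℕ a + toℕ b) mod m) + toℕ c) % m   ≡⟨ cong (λ t → (t + toℕ c) % m) (toℕ-mod (toℕ a + toℕ b)) ⟩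
    ((toℕ a + toℕ b) % m + toℕ c) % m           ≡⟨ %-absorbˡ (toℕ a + toℕ b) (toℕ c) ⟩
    (toℕ a + toℕ b + toℕ c) % m                 ≡⟨ cong (_% m) (+-assoc (toℕ a) (toℕ b) (toℕ c)) ⟩
    (toℕ a + (toℕ b + toℕ c)) % m               ≡⟨ %-absorbʳ (toℕ a) (toℕ b + toℕ c) ⟨
    (toℕ a + (toℕ b + toℕ c) % m) % m           ≡⟨ cong (λ t → (toℕ a + t) % m) (toℕ-mod (toℕ b + toℕ c)) ⟨
    (toℕ a + toℕ ((toℕ b + toℕ c) mod m)) % m   ∎)
    where open ≡-Reasoning

  +ₘ-identityʳ : ∀ a → _+ₘ_ m a (0ₘ m) ≡ a
  +ₘ-identityʳ a = begin
    (toℕ a + toℕ (0ₘ m)) mod m   ≡⟨ cong (λ t → (toℕ a + t) mod m) toℕ-0ₘ ⟩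
    (toℕ a + 0) mod m            ≡⟨ cong (_mod m) (+-identityʳ (toℕ a)) ⟩
    toℕ a mod m                  ≡⟨ toℕ-mod-toℕ a ⟩
    a                            ∎
    where open ≡-Reasoning

  +ₘ-inverseʳ : ∀ a → _+ₘ_ m a (-ₘ a) ≡ 0ₘ m
  +ₘ-inverseʳ a = mod-cong (begin
    (toℕ a + toℕ ((m ∸ toℕ a) mod m)) % m   ≡⟨ cong (λ t → (toℕ a + t) % m) (toℕ-mod (m ∸ toℕ a)) ⟩
    (toℕ a + (m ∸ toℕ a) % m) % m           ≡⟨ %-absorbʳ (toℕ a) (m ∸ toℕ a) ⟩
    (toℕ a + (m ∸ toℕ a)) % m               ≡⟨ cong (_% m) (m+[n∸m]≡n (<⇒≤ (toℕ<n a))) ⟩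
    m % m                                   ≡⟨ n%n≡0 m ⟩
    0                                       ≡⟨ m*n%n≡0 0 m ⟨
    0 % m                                   ∎)
    where open ≡-Reasoning

  abelianGroup : AbelianGroup 0ℓ 0ℓ
  abelianGroup = record
    { Carrier = ℤ_ m
    ; _≈_ = _≡_
    ; _∙_ = _+ₘ_ m
    ; ε = 0ₘ m
    ; _⁻¹ = -ₘ_
    ; isAbelianGroup = record
      { isGroup = record
        { isMonoid = record
          { isSemigroup = record { isMagma = isMagma (_+ₘ_ m) ; assoc = +ₘ-assoc }
          ; identity = (λ a → trans (+ₘ-comm (0ₘ m) a) (+ₘ-identityʳ a)) , +ₘ-identityʳ
          }
        ; inverse = (λ a → trans (+ₘ-comm (-ₘ a) a) (+ₘ-inverseʳ a)) , +ₘ-inverseʳ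
        ; ⁻¹-cong = cong -ₘ_
        }
      ; comm = +ₘ-comm
      }
    }

  open RawMonoidDefinitions (AbelianGroup.rawMonoid abelianGroup) public using () renaming (_×_ to _×ₘ_)

  toℕ-×ₘ : ∀ k a → toℕ (k ×ₘ a) ≡ (k * toℕ a) % m
  toℕ-×ₘ zero    a = trans toℕ-0ₘ (sym (m*n%n≡0 0 m))
  toℕ-×ₘ (suc k) a = begin
    toℕ ((toℕ a + toℕ (k ×ₘ a)) mod m)   ≡⟨ toℕ-mod (toℕ a + toℕ (k ×ₘ a)) ⟩
    (toℕ a + toℕ (k ×ₘ a)) % m           ≡⟨ cong (λ t → (toℕ a + t) % m) (toℕ-×ₘ k a) ⟩
    (toℕ a + (k * toℕ a) % m) % m       ≡⟨ %-absorbʳ (toℕ a) (k * toℕ a) ⟩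
    (toℕ a + k * toℕ a) % m             ∎
    where open ≡-Reasoning

configGroup : (n m : ℕ) .{{_ : NonZero m}} → AbelianGroup 0ℓ 0ℓ
configGroup n m = Pointwise.abelianGroup (Fin n) (ℤₘ.abelianGroup m)

private variable A B C : Set

length-cartesianProductWith : (f : A → B → C) (xs : List A) (ys : List B) →
  length (cartesianProductWith f xs ys) ≡ length xs * length ys
length-cartesianProductWith f []       ys = refl
length-cartesianProductWith f (x ∷ xs) ys =
  trans (length-++ (map (f x) ys))
        (cong₂ _+_ (length-map (f x) ys) (length-cartesianProductWith f xs ys))

vectors : List A → (k : ℕ) → List (Vec A k)
vectors xs zero    = [] ∷ []
vectors xs (suc k) = cartesianProductWith _∷_ xs (vectors xs k)

∈-vectors⁺ : ∀ {xs : List A} {k} {v : Vec A k} → VecAll.All (_∈ xs) v → v ∈ vectors xs k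
∈-vectors⁺ VecAll.[]         = here refl
∈-vectors⁺ (x∈ VecAll.∷ v∈) = ∈-cartesianProductWith⁺ _∷_ x∈ (∈-vectors⁺ v∈)

vectors-unique : ∀ {xs : List A} k → Unique xs → Unique (vectors xs k)
vectors-unique zero    _  = [] ∷ []
vectors-unique (suc k) xs! =
  Unique.cartesianProductWith⁺ _∷_ Vec.∷-injective xs! (vectors-unique k xs!)

length-vectors : ∀ (xs : List A) k → length (vectors xs k) ≡ length xs ^ k
length-vectors xs zero    = refl
length-vectors xs (suc k) =
  trans (length-cartesianProductWith _∷_ xs (vectors xs k)) (cong (length xs *_) (length-vectors xs k))

lists : List A → ℕ → List (List A)
lists xs zero    = [] ∷ []
lists xs (suc k) = cartesianProductWith _∷_ xs (lists xs k)

∈-lists⁺ : ∀ {xs : List A} k {t} → length t ≡ k → All (_∈ xs) t → t ∈ lists xs k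
∈-lists⁺ zero    {[]}    _   _          = here refl
∈-lists⁺ (suc k) {x ∷ t} len (x∈ ∷ t∈) = ∈-cartesianProductWith⁺ _∷_ x∈ (∈-lists⁺ k (suc-injective len) t∈)

∈-lists⁻ : ∀ (xs : List A) k {t} → t ∈ lists xs k → length t ≡ k × All (_∈ xs) t
∈-lists⁻ xs zero    (here refl) = refl , []
∈-lists⁻ xs (suc k) t∈ with ∈-cartesianProductWith⁻ _∷_ xs (lists xs k) t∈
... | x , t′ , x∈ , t′∈ , refl = let len , all = ∈-lists⁻ xs k t′∈ in cong suc len , x∈ ∷ all

lists-unique : ∀ {xs : List A} k → Unique xs → Unique (lists xs k)
lists-unique zero    _   = [] ∷ []
lists-unique (suc k) xs! = Unique.cartesianProductWith⁺ _∷_ ∷-injective xs! (lists-unique k xs!)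

length-lists : ∀ (xs : List A) k → length (lists xs k) ≡ length xs ^ k
length-lists xs zero    = refl
length-lists xs (suc k) =
  trans (length-cartesianProductWith _∷_ xs (lists xs k)) (cong (length xs *_) (length-lists xs k))

∈-─ : ∀ {x y : A} {ys} (p : x ∈ ys) → y ∈ ys → y ≢ x → y ∈ (ys ─ p)
∈-─ (here refl) (here refl) y≢x = ⊥-elim (y≢x refl)
∈-─ (here _)    (there q)   _   = q
∈-─ (there p)   (here eq)   _   = here eq
∈-─ (there p)   (there q)   y≢x = there (∈-─ p q y≢x)

injective⇒length-≤ : (f : A → B) {xs : List A} {ys : List B} → Unique xs →
  (∀ {x} → x ∈ xs → f x ∈ ys) →
  (∀ {x x′} → x ∈ xs → x′ ∈ xs → f x ≡ f x′ → x ≡ x′) →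
  length xs ≤ length ys
injective⇒length-≤ f {[]}     _           _    _   = z≤n
injective⇒length-≤ f {x ∷ xs} {ys} (x∉ ∷ xs!) into inj =
  subst (suc (length xs) ≤_) (sym (length-removeAt′ ys (index fx∈)))
    (s≤s (injective⇒length-≤ f xs!
      (λ x′∈ → ∈-─ fx∈ (into (there x′∈)) (λ eq → All.lookup x∉ x′∈ (inj (here refl) (there x′∈) (sym eq))))
      (λ x₁∈ x₂∈ → inj (there x₁∈) (there x₂∈))))
  where fx∈ = into (here refl)

module _ {P : A → Set} (P? : Decidable P) where

  length-filter+filter∁ : ∀ xs → length xs ≡ length (filter P? xs) + length (filter (λ x → ¬? (P? x)) xs)
  length-filter+filter∁ []       = refl
  length-filter+filter∁ (x ∷ xs) with P? x
  ... | yes _ = cong suc (length-filter+filter∁ xs)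
  ... | no  _ = trans (cong suc (length-filter+filter∁ xs)) (sym (+-suc _ _))

  pick : List A → A → A
  pick []       d = d
  pick (x ∷ xs) d with P? x
  ... | yes _ = x
  ... | no  _ = pick xs d

  pick-spec : ∀ {xs} d → Any P xs → pick xs d ∈ xs × P (pick xs d)
  pick-spec {x ∷ xs} d p with P? x | p
  ... | yes px | _         = here refl , px
  ... | no ¬px | here px   = ⊥-elim (¬px px)
  ... | no _   | there pxs = let p∈ , ppick = pick-spec d pxs in there p∈ , ppick

module _ {P Q : A → Set} (P? : Decidable P) (Q? : Decidable Q) where

  filter-filter : (∀ {x} → Q x → P x) → ∀ xs → filter Q? (filter P? xs) ≡ filter Q? xs
  filter-filter Q⊆P []       = refl
  filter-filter Q⊆P (x ∷ xs) with Q? x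
  ... | yes qx = trans (cong (filter Q?) (filter-accept P? (Q⊆P qx)))
                       (trans (filter-accept Q? qx) (cong (x ∷_) (filter-filter Q⊆P xs)))
  ... | no ¬qx with P? x
  ...   | yes _ = trans (filter-reject Q? ¬qx) (filter-filter Q⊆P xs)
  ...   | no  _ = filter-filter Q⊆P xs

  pick-cong : (∀ {x} → P x → Q x) → (∀ {x} → Q x → P x) → ∀ xs d → pick P? xs d ≡ pick Q? xs d
  pick-cong P⇒Q Q⇒P []       d = refl
  pick-cong P⇒Q Q⇒P (x ∷ xs) d with P? x | Q? x
  ... | yes _  | yes _  = refl
  ... | yes px | no ¬qx = ⊥-elim (¬qx (P⇒Q px))
  ... | no ¬px | yes qx = ⊥-elim (¬px (Q⇒P qx))
  ... | no _   | no _   = pick-cong P⇒Q Q⇒P xs d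

  length-filter-mono : (∀ {x} → P x → Q x) → ∀ xs → length (filter P? xs) ≤ length (filter Q? xs)
  length-filter-mono P⊆Q []       = z≤n
  length-filter-mono P⊆Q (x ∷ xs) with P? x | Q? x
  ... | yes _  | yes _  = s≤s (length-filter-mono P⊆Q xs)
  ... | yes px | no ¬qx = ⊥-elim (¬qx (P⊆Q px))
  ... | no _   | yes _  = m≤n⇒m≤1+n (length-filter-mono P⊆Q xs)
  ... | no _   | no _   = length-filter-mono P⊆Q xs

  length-filter-strictMono : (∀ {x} → P x → Q x) → ∀ {x xs} → x ∈ xs → Q x → ¬ P x →
    length (filter P? xs) < length (filter Q? xs)
  length-filter-strictMono P⊆Q {xs = y ∷ xs} x∈ qx ¬px with P? y | Q? y | x∈
  ... | yes py | _      | here refl = ⊥-elim (¬px py)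
  ... | no _   | yes _  | here refl = s≤s (length-filter-mono P⊆Q xs)
  ... | no _   | no ¬qy | here refl = ⊥-elim (¬qy qx)
  ... | yes _  | yes _  | there x∈′ = s≤s (length-filter-strictMono P⊆Q x∈′ qx ¬px)
  ... | yes py | no ¬qy | there _   = ⊥-elim (¬qy (P⊆Q py))
  ... | no _   | yes _  | there x∈′ = m≤n⇒m≤1+n (length-filter-strictMono P⊆Q x∈′ qx ¬px)
  ... | no _   | no _   | there x∈′ = length-filter-strictMono P⊆Q x∈′ qx ¬px

module _ (P : ℕ → A → Set) (P? : ∀ j → Decidable (P j)) (xs : List A)
         (P-mono : ∀ {j x} → P j x → P (suc j) x)
         (P-grows : ∀ j → ¬ All (P j) xs → ∃ λ x → x ∈ xs × P (suc j) x × ¬ P j x) where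

  private
    grows : ∀ j → All (P j) xs ⊎ j ≤ length (filter (P? j) xs)
    grows zero    = inj₂ z≤n
    grows (suc j) with all? (P? j) xs | grows j
    ... | yes all | _          = inj₁ (All.map P-mono all)
    ... | no ¬all | inj₁ all   = ⊥-elim (¬all all)
    ... | no ¬all | inj₂ j≤#   = let x , x∈ , px , ¬px = P-grows j ¬all in
      inj₂ (≤-<-trans j≤# (length-filter-strictMono (P? j) (P? (suc j)) P-mono x∈ px ¬px))

  chain-exhausts : All (P (suc (length xs))) xs
  chain-exhausts with grows (suc (length xs))
  ... | inj₁ all = all
  ... | inj₂ len< = ⊥-elim (<-irrefl refl (<-≤-trans len< (length-filter (P? _) xs)))

∈⇒nonZero-length : ∀ {x : A} {xs} → x ∈ xs → NonZero (length xs)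
∈⇒nonZero-length (here _)  = _
∈⇒nonZero-length (there _) = _

∈-length≡1⇒≡ : ∀ {xs : List A} {x y} → length xs ≡ 1 → x ∈ xs → y ∈ xs → x ≡ y
∈-length≡1⇒≡ {xs = _ ∷ []} _ (here refl) (here refl) = refl

2≤length⇒∃≢ : DecidableEquality A → ∀ {xs : List A} → Unique xs → 2 ≤ length xs → ∀ a → ∃ λ x → x ∈ xs × x ≢ a
2≤length⇒∃≢ _≟_ {x₁ ∷ x₂ ∷ _} ((x₁≢x₂ ∷ _) ∷ _) _ a with x₁ ≟ a
... | no  x₁≢a  = x₁ , here refl , x₁≢a
... | yes refl = x₂ , there (here refl) , λ x₂≡x₁ → x₁≢x₂ (sym x₂≡x₁)
2≤length⇒∃≢ _ {_ ∷ []} _ (s≤s ()) _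

prime∣^⇒∣ : ∀ {r ℓ} → Prime r → ∀ a → r ∣ ℓ ^ a → r ∣ ℓ
prime∣^⇒∣ pr zero    r∣1 = ⊥-elim (¬prime[1] (subst Prime (∣1⇒≡1 r∣1) pr))
prime∣^⇒∣ {ℓ = ℓ} pr (suc a) r∣ℓ^[1+a] with euclidsLemma ℓ (ℓ ^ a) pr r∣ℓ^[1+a]
... | inj₁ r∣ℓ   = r∣ℓ
... | inj₂ r∣ℓ^a = prime∣^⇒∣ pr a r∣ℓ^a

prime∣prime⇒≡ : ∀ {r ℓ} → Prime r → Prime ℓ → r ∣ ℓ → r ≡ ℓ
prime∣prime⇒≡ pr pℓ r∣ℓ with prime⇒irreducible pℓ r∣ℓ
... | inj₁ refl = ⊥-elim (¬prime[1] pr)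
... | inj₂ r≡ℓ  = r≡ℓ

∈⇒∣product : ∀ {r as} → r ∈ as → r ∣ product as
∈⇒∣product {as = _ ∷ as} (here refl) = m∣m*n (product as)
∈⇒∣product {as = a ∷ _}  (there r∈)  = ∣-trans (∈⇒∣product r∈) (n∣m*n a)

∃-prime∣ : ∀ d → d ≢ 0 → d ≢ 1 → ∃ λ r → Prime r × r ∣ d
∃-prime∣ d d≢0 d≢1 with factorise d {{≢-nonZero d≢0}}
... | record { factors = [] ; isFactorisation = d≡1 } = ⊥-elim (d≢1 d≡1)
... | record { factors = r ∷ rs ; isFactorisation = d≡Π ; factorsPrime = pr ∷ _ } =
  r , pr , subst (r ∣_) (sym d≡Π) (∈⇒∣product {as = r ∷ rs} (here refl))

∣^∧≢1⇒∣ : ∀ {ℓ d} a → Prime ℓ → d ∣ ℓ ^ a → d ≢ 1 → ℓ ∣ d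
∣^∧≢1⇒∣ {ℓ} {d} a pℓ d∣ℓ^a d≢1 =
  let r , pr , r∣d = ∃-prime∣ d d≢0 d≢1
  in subst (_∣ d) (prime∣prime⇒≡ pr pℓ (prime∣^⇒∣ pr a (∣-trans r∣d d∣ℓ^a))) r∣d
  where
  d≢0 : d ≢ 0
  d≢0 refl = ≢-nonZero⁻¹ (ℓ ^ a) {{m^n≢0 ℓ a {{prime⇒nonZero pℓ}}}} (0∣⇒≡0 d∣ℓ^a)

only-prime∣⇒≡^ : ∀ {p} k → k ≢ 0 → (∀ {r} → Prime r → r ∣ k → r ≡ p) → ∃ λ a → k ≡ p ^ a
only-prime∣⇒≡^ {p} k k≢0 only-p with factorise k {{≢-nonZero k≢0}}
... | record { factors = rs ; isFactorisation = k≡Π ; factorsPrime = prs } =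
  length rs , trans k≡Π (product-≡^ (all≡p prs (λ r∈ → subst (_ ∣_) (sym k≡Π) (∈⇒∣product r∈))))
  where
  all≡p : ∀ {rs} → All Prime rs → (∀ {r} → r ∈ rs → r ∣ k) → All (_≡ p) rs
  all≡p []         _   = []
  all≡p (pr ∷ prs) ∣k = only-p pr (∣k (here refl)) ∷ all≡p prs (λ r∈ → ∣k (there r∈))
  product-≡^ : ∀ {rs} → All (_≡ p) rs → product rs ≡ p ^ length rs
  product-≡^ []           = refl
  product-≡^ (refl ∷ all) = cong (p *_) (product-≡^ all)

≡^∧≢1⇒1≤ : ∀ {x p} c → x ≡ p ^ c → x ≢ 1 → 1 ≤ c
≡^∧≢1⇒1≤ zero    x≡1 x≢1 = ⊥-elim (x≢1 x≡1)
≡^∧≢1⇒1≤ (suc c) _   _   = s≤s z≤n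

samePrime⇒winCondition : ∀ {k m} → k ≢ 0 → m ≢ 0 →
  (∀ {p r} → Prime p → p ∣ m → Prime r → r ∣ k → r ≡ p) → WinCondition k m
samePrime⇒winCondition {k} {m} k≢0 m≢0 same with k ℕ.≟ 1 | m ℕ.≟ 1
... | yes k≡1 | _       = inj₁ k≡1
... | no _    | yes m≡1 = inj₂ (inj₁ m≡1)
... | no k≢1  | no m≢1  =
  let r , pr , r∣k  = ∃-prime∣ k k≢0 k≢1
      p , pp , p∣m  = ∃-prime∣ m m≢0 m≢1
      a , k≡p^a     = only-prime∣⇒≡^ k k≢0 (same pp p∣m)
      b , m≡p^b     = only-prime∣⇒≡^ m m≢0 λ ps s∣m → trans (sym (same ps s∣m pr r∣k)) (same pp p∣m pr r∣k)
  in inj₂ (inj₂ (p , a , b , pp , ≡^∧≢1⇒1≤ a k≡p^a k≢1 , ≡^∧≢1⇒1≤ b m≡p^b m≢1 , k≡p^a , m≡p^b))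

prime∣length⇒∃≢ : ∀ {A : Set} {p} → DecidableEquality A → Prime p → ∀ {xs : List A} {x₀} →
  Unique xs → p ∣ length xs → x₀ ∈ xs → ∃ λ x → x ∈ xs × x ≢ x₀
prime∣length⇒∃≢ {p = p} _≟_ pp {xs} xs! p∣ x₀∈ =
  2≤length⇒∃≢ _≟_ xs! (≤-trans (nonTrivial⇒n>1 p {{prime⇒nonTrivial pp}}) (∣⇒≤ {{nonEmpty}} p∣)) _
  where
  nonEmpty : NonZero (length xs)
  nonEmpty = ∈⇒nonZero-length x₀∈

-- Orbit counting

module FiniteGroupAction
  {C Y : Set} (_≟C_ : DecidableEquality C) (_≟Y_ : DecidableEquality Y)
  (_⋆_ : C → C → C) (e : C) (G : List C) (G! : Unique G) (e∈G : e ∈ G)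
  (⋆∈G : ∀ {a b} → a ∈ G → b ∈ G → a ⋆ b ∈ G)
  (inverse∈G : ∀ {a} → a ∈ G → Any (λ b → b ⋆ a ≡ e × a ⋆ b ≡ e) G)
  (⋆-assoc : ∀ a b c → (a ⋆ b) ⋆ c ≡ a ⋆ (b ⋆ c))
  (⋆-identityˡ : ∀ a → e ⋆ a ≡ a) (⋆-identityʳ : ∀ a → a ⋆ e ≡ a)
  (_·_ : C → Y → Y) (Dom : Y → Set)
  (·-identity : ∀ {y} → Dom y → e · y ≡ y)
  (·-⋆ : ∀ {a b} → a ∈ G → b ∈ G → ∀ {y} → Dom y → (a ⋆ b) · y ≡ b · (a · y))
  where

  infix 21 _⁻¹

  _⁻¹ : C → C
  a ⁻¹ = pick (λ b → ((b ⋆ a) ≟C e) ×-dec ((a ⋆ b) ≟C e)) G e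

  ⁻¹-spec : ∀ {a} → a ∈ G → a ⁻¹ ∈ G × a ⁻¹ ⋆ a ≡ e × a ⋆ a ⁻¹ ≡ e
  ⁻¹-spec a∈ = pick-spec (λ b → ((b ⋆ _) ≟C e) ×-dec ((_ ⋆ b) ≟C e)) e (inverse∈G a∈)

  ⁻¹∈G : ∀ {a} → a ∈ G → a ⁻¹ ∈ G
  ⁻¹∈G a∈ = proj₁ (⁻¹-spec a∈)

  ⋆-cancelʳ : ∀ {a b c} → c ∈ G → a ⋆ c ≡ b ⋆ c → a ≡ b
  ⋆-cancelʳ {a} {b} {c} c∈ eq = trans (sym (undo a)) (trans (cong (_⋆ c ⁻¹) eq) (undo b))
    where
    undo : ∀ x → (x ⋆ c) ⋆ c ⁻¹ ≡ x
    undo x = trans (⋆-assoc x c (c ⁻¹)) (trans (cong (x ⋆_) (proj₂ (proj₂ (⁻¹-spec c∈)))) (⋆-identityʳ x))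

  ·-⁻¹ : ∀ {h} → h ∈ G → ∀ {y} → Dom y → h ⁻¹ · (h · y) ≡ y
  ·-⁻¹ h∈ {y} dy = trans (sym (·-⋆ h∈ (⁻¹∈G h∈) dy))
                         (trans (cong (_· y) (proj₂ (proj₂ (⁻¹-spec h∈)))) (·-identity dy))

  Closed : List Y → Set
  Closed ys = (∀ {y h} → y ∈ ys → h ∈ G → h · y ∈ ys) × (∀ {y} → y ∈ ys → Dom y)

  InOrbit : Y → Y → Set
  InOrbit y z = Any (λ h → h · y ≡ z) G

  inOrbit? : ∀ y z → Dec (InOrbit y z)
  inOrbit? y z = any? (λ h → (h · y) ≟Y z) G

  ·∈orbit : ∀ {h} → h ∈ G → ∀ y → InOrbit y (h · y)
  ·∈orbit h∈ y = Any.map (λ h≡ → cong (_· y) (sym h≡)) h∈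

  ∈orbit : ∀ {y} → Dom y → InOrbit y y
  ∈orbit dy = Any.map (λ e≡ → trans (cong (_· _) (sym e≡)) (·-identity dy)) e∈G

  Fixed : Y → Set
  Fixed y = All (λ h → h · y ≡ y) G

  fixed? : ∀ y → Dec (Fixed y)
  fixed? y = all? (λ h → (h · y) ≟Y y) G

  orbitIn : Y → List Y → List Y
  orbitIn y = filter (inOrbit? y)

  fixedIn : List Y → List Y
  fixedIn = filter fixed?

  transporter : Y → Y → C
  transporter y z = pick (λ h → (h · y) ≟Y z) G e

  transporter-spec : ∀ {y z} → InOrbit y z → transporter y z ∈ G × transporter y z · y ≡ z
  transporter-spec = pick-spec (λ h → (_ · _) ≟Y _) e

  module OrbitStabiliser {y ys} (ys! : Unique ys) (closed : Closed ys) (y∈ : y ∈ ys) where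

    dy : Dom y
    dy = proj₂ closed y∈

    stabiliser : List C
    stabiliser = filter (λ h → (h · y) ≟Y y) G

    private
      τ = transporter y

      split : C → Y × C
      split h = h · y , h ⋆ τ (h · y) ⁻¹

      join : Y × C → C
      join (z , s) = s ⋆ τ z

      split∈ : ∀ {h} → h ∈ G → split h ∈ cartesianProduct (orbitIn y ys) stabiliser
      split∈ {h} h∈ = ∈-cartesianProduct⁺
        (∈-filter⁺ (inOrbit? y) (proj₁ closed y∈ h∈) (·∈orbit h∈ y))
        (∈-filter⁺ (λ h → (h · y) ≟Y y) (⋆∈G h∈ (⁻¹∈G τ∈)) (begin
          (h ⋆ τ (h · y) ⁻¹) · y     ≡⟨ ·-⋆ h∈ (⁻¹∈G τ∈) dy ⟩
          τ (h · y) ⁻¹ · (h · y)     ≡⟨ cong (τ (h · y) ⁻¹ ·_) (sym τy≡) ⟩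
          τ (h · y) ⁻¹ · (τ (h · y) · y) ≡⟨ ·-⁻¹ τ∈ dy ⟩
          y                          ∎))
        where
        open ≡-Reasoning
        τ∈ = proj₁ (transporter-spec (·∈orbit h∈ y))
        τy≡ = proj₂ (transporter-spec (·∈orbit h∈ y))

      split-injective : ∀ {h h′} → h ∈ G → h′ ∈ G → split h ≡ split h′ → h ≡ h′
      split-injective {h} {h′} h∈ _ eq = ⋆-cancelʳ (⁻¹∈G (proj₁ (transporter-spec (·∈orbit h∈ y))))
        (trans (,-injectiveʳ eq) (cong (λ z → h′ ⋆ τ z ⁻¹) (sym (,-injectiveˡ eq))))

      components : ∀ {p} → p ∈ cartesianProduct (orbitIn y ys) stabiliser →
                   (τ (proj₁ p) ∈ G × τ (proj₁ p) · y ≡ proj₁ p) × (proj₂ p ∈ G × proj₂ p · y ≡ y)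
      components {z , s} p∈ =
        let z∈ , s∈ = ∈-cartesianProduct⁻ (orbitIn y ys) stabiliser p∈
        in transporter-spec (proj₂ (∈-filter⁻ (inOrbit? y) {xs = ys} z∈))
         , ∈-filter⁻ (λ h → (h · y) ≟Y y) {xs = G} s∈

      join∈ : ∀ {p} → p ∈ cartesianProduct (orbitIn y ys) stabiliser → join p ∈ G
      join∈ p∈ = let (τ∈ , _) , (s∈ , _) = components p∈ in ⋆∈G s∈ τ∈

      join-· : ∀ {p} → p ∈ cartesianProduct (orbitIn y ys) stabiliser → join p · y ≡ proj₁ p
      join-· {z , s} p∈ =
        let (τ∈ , τy≡z) , (s∈ , sy≡y) = components p∈
        in trans (·-⋆ s∈ τ∈ dy) (trans (cong (τ z ·_) sy≡y) τy≡z)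

      join-injective : ∀ {p p′} → p ∈ cartesianProduct (orbitIn y ys) stabiliser →
        p′ ∈ cartesianProduct (orbitIn y ys) stabiliser → join p ≡ join p′ → p ≡ p′
      join-injective {z , s} {z′ , s′} p∈ p′∈ eq =
        cong₂ _,_ z≡z′ (⋆-cancelʳ (proj₁ (proj₁ (components p∈))) (trans eq (cong (λ t → s′ ⋆ τ t) (sym z≡z′))))
        where
        z≡z′ : z ≡ z′
        z≡z′ = trans (sym (join-· p∈)) (trans (cong (_· y) eq) (join-· p′∈))

    orbit-stabiliser : length G ≡ length (orbitIn y ys) * length stabiliser
    orbit-stabiliser = trans
      (≤-antisym (injective⇒length-≤ split G! split∈ split-injective)
                 (injective⇒length-≤ join (Unique.cartesianProduct⁺ (Unique.filter⁺ _ ys!) (Unique.filter⁺ _ G!))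
                                      join∈ join-injective))
      (length-cartesianProductWith _,_ (orbitIn y ys) stabiliser)

    singleton⇒fixed : length (orbitIn y ys) ≡ 1 → Fixed y
    singleton⇒fixed |O|≡1 = All.tabulate λ h∈ → ∈-length≡1⇒≡ |O|≡1
      (∈-filter⁺ (inOrbit? y) (proj₁ closed y∈ h∈) (·∈orbit h∈ y))
      (∈-filter⁺ (inOrbit? y) y∈ (∈orbit dy))

  module _ {y} (dy : Dom y) where

    fixed∉orbit : ¬ Fixed y → ∀ {z} → Fixed z → ¬ InOrbit y z
    fixed∉orbit ¬fixed {z} fixed-z y~z with find y~z
    ... | h , h∈ , hy≡z = ¬fixed (subst Fixed (sym y≡z) fixed-z)
      where
      y≡z : y ≡ z
      y≡z = trans (sym (·-⁻¹ h∈ dy)) (trans (cong (h ⁻¹ ·_) hy≡z) (All.lookup fixed-z (⁻¹∈G h∈)))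

    outsideOrbit : List Y → List Y
    outsideOrbit = filter (λ z → ¬? (inOrbit? y z))

    Closed-outsideOrbit : ∀ {ys} → Closed ys → Closed (outsideOrbit ys)
    Closed-outsideOrbit {ys} (·∈ys , dom) = ·∈outside , λ z∈ → dom (proj₁ (∈-filter⁻ _ {xs = ys} z∈))
      where
      ·∈outside : ∀ {z h} → z ∈ outsideOrbit ys → h ∈ G → h · z ∈ outsideOrbit ys
      ·∈outside {z} {h} z∈ h∈ with ∈-filter⁻ _ {xs = ys} z∈
      ... | z∈ys , z∉orbit = ∈-filter⁺ _ (·∈ys z∈ys h∈) λ y~hz →
        let g , g∈ , gy≡hz = find y~hz
        in z∉orbit (lose (⋆∈G g∈ (⁻¹∈G h∈))
             (trans (·-⋆ g∈ (⁻¹∈G h∈) dy) (trans (cong (h ⁻¹ ·_) gy≡hz) (·-⁻¹ h∈ (dom z∈ys)))))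

  module _ {ℓ a} (pℓ : Prime ℓ) (|G|≡ℓ^a : length G ≡ ℓ ^ a) where

    ℓ∣orbit : ∀ {y ys} → Unique ys → Closed ys → y ∈ ys → ¬ Fixed y → ℓ ∣ length (orbitIn y ys)
    ℓ∣orbit {y} {ys} ys! closed y∈ ¬fixed =
      ∣^∧≢1⇒∣ a pℓ (divides (length stabiliser) |G|≡|stabiliser|*|orbit|) (λ |O|≡1 → ¬fixed (singleton⇒fixed |O|≡1))
      where
      open OrbitStabiliser ys! closed y∈
      |G|≡|stabiliser|*|orbit| : ℓ ^ a ≡ length stabiliser * length (orbitIn y ys)
      |G|≡|stabiliser|*|orbit| = trans (sym |G|≡ℓ^a) (trans orbit-stabiliser (*-comm (length (orbitIn y ys)) _))

    private
      ℓ∣fixedIn-bounded : ∀ N {ys} → length ys ≤ N → Unique ys → Closed ys →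
                          ℓ ∣ length ys → ℓ ∣ length (fixedIn ys)
      ℓ∣fixedIn-bounded N {ys} _ _ _ ℓ∣ys with all? fixed? ys
      ... | yes all-fixed = subst (λ xs → ℓ ∣ length xs) (sym (filter-all fixed? all-fixed)) ℓ∣ys
      ℓ∣fixedIn-bounded N       {[]}    _  _ _ _ | no ¬all = ⊥-elim (¬all [])
      ℓ∣fixedIn-bounded zero    {_ ∷ _} () _ _ _ | no _
      ℓ∣fixedIn-bounded (suc N) {ys} |ys|≤ ys! closed ℓ∣ys | no ¬all with find (¬All⇒Any¬ fixed? ys ¬all)
      ... | y , y∈ , ¬fixed =
        subst (λ xs → ℓ ∣ length xs) (filter-filter _ fixed? (fixed∉orbit dy ¬fixed) ys)
          (ℓ∣fixedIn-bounded N |rest|≤N (Unique.filter⁺ _ ys!) (Closed-outsideOrbit dy closed) ℓ∣rest)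
        where
        dy = proj₂ closed y∈
        |rest|≤N : length (outsideOrbit dy ys) ≤ N
        |rest|≤N = ≤-pred (≤-trans (filter-notAll _ ys (Any.map (λ { refl y∉ → y∉ (∈orbit dy) }) y∈)) |ys|≤)
        ℓ∣rest : ℓ ∣ length (outsideOrbit dy ys)
        ℓ∣rest = ∣m+n∣m⇒∣n (subst (ℓ ∣_) (length-filter+filter∁ (inOrbit? _) ys) ℓ∣ys)
                           (ℓ∣orbit ys! closed y∈ ¬fixed)

    ℓ∣fixedIn : ∀ {ys} → Unique ys → Closed ys → ℓ ∣ length ys → ℓ ∣ length (fixedIn ys)
    ℓ∣fixedIn = ℓ∣fixedIn-bounded _ ≤-refl

-- The layers of the game

module Game {n : ℕ} (m : ℕ) .{{_ : NonZero m}} (S : List (Permutation′ n)) where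

  open AbelianGroup (configGroup n m) public
    using (_≈_; _∙_; ε; _⁻¹; _-_; ∙-cong; ∙-congˡ; ∙-congʳ; ⁻¹-cong; inverseʳ; identityʳ)
    renaming (refl to ≈-refl; sym to ≈-sym; trans to ≈-trans)
  open AbelianGroupProperties (configGroup n m) public
    using (⁻¹-anti-homo‿-; ⁻¹-∙-comm; ε⁻¹≈ε; //-rightDividesˡ; //-cong₂; ∙-cancelˡ)
  open AbelianGroupLemmas (configGroup n m) public

  -- s ▷ v moves the counter at position i to position s i; v ◁ s moves it back.
  _▷_ : Permutation′ n → Config n m → Config n m
  (s ▷ v) i = v (s ⟨$⟩ˡ i)

  _◁_ : Config n m → Permutation′ n → Config n m
  (v ◁ s) i = v (s ⟨$⟩ʳ i)

  Layer : ℕ → Config n m → Set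
  Layer zero    v = v ≈ ε
  Layer (suc j) v = All (λ s → Layer j ((v ◁ s) - v)) S

  layer? : ∀ j v → Dec (Layer j v)
  layer? zero    v = Fin.all? (λ i → v i Fin.≟ 0ₘ m)
  layer? (suc j) v = All.all? (λ s → layer? j ((v ◁ s) - v)) S

  Layer-resp : ∀ j {u v} → u ≈ v → Layer j u → Layer j v
  Layer-resp zero    u≈v u∈ = ≈-trans (≈-sym u≈v) u∈
  Layer-resp (suc j) u≈v u∈ = All.map (Layer-resp j (∙-cong (λ i → u≈v _) (⁻¹-cong u≈v))) u∈

  Layer-ε : ∀ j → Layer j ε
  Layer-ε zero    = ≈-refl
  Layer-ε (suc j) = All.tabulate λ _ → Layer-resp j (≈-sym (inverseʳ ε)) (Layer-ε j)

  Layer-∙ : ∀ j {u v} → Layer j u → Layer j v → Layer j (u ∙ v)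
  Layer-∙ zero    u∈ v∈ = ≈-trans (∙-cong u∈ v∈) (identityʳ ε)
  Layer-∙ (suc j) {u} {v} u∈ v∈ = All.zipWith
    (λ {s} (u◁s-u∈ , v◁s-v∈) → Layer-resp j (≈-sym (-‿interchange (u ◁ s) (v ◁ s) u v)) (Layer-∙ j u◁s-u∈ v◁s-v∈))
    (u∈ , v∈)

  Layer-⁻¹ : ∀ j {u} → Layer j u → Layer j (u ⁻¹)
  Layer-⁻¹ zero    u∈ = ≈-trans (⁻¹-cong u∈) ε⁻¹≈ε
  Layer-⁻¹ (suc j) {u} u∈ = All.map (λ {s} d∈ → Layer-resp j (≈-sym (⁻¹-∙-comm (u ◁ s) (u ⁻¹))) (Layer-⁻¹ j d∈)) u∈

  Layer-- : ∀ j {u v} → Layer j u → Layer j v → Layer j (u - v)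
  Layer-- j u∈ v∈ = Layer-∙ j u∈ (Layer-⁻¹ j v∈)

  _∼[_]_ : Config n m → ℕ → Config n m → Set
  u ∼[ j ] v = Layer j (u - v)

  ∼-refl : ∀ j {u} → u ∼[ j ] u
  ∼-refl j {u} = Layer-resp j (≈-sym (inverseʳ u)) (Layer-ε j)

  ∼-sym : ∀ j {u v} → u ∼[ j ] v → v ∼[ j ] u
  ∼-sym j {u} {v} u∼v = Layer-resp j (⁻¹-anti-homo‿- u v) (Layer-⁻¹ j u∼v)

  ∼-trans : ∀ j {u v w} → u ∼[ j ] v → v ∼[ j ] w → u ∼[ j ] w
  ∼-trans j {u} {v} {w} u∼v v∼w = Layer-resp j (-‿trans u v w) (Layer-∙ j u∼v v∼w)

  ≈⇒∼ : ∀ j {u v} → u ≈ v → u ∼[ j ] v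
  ≈⇒∼ j {u} u≈v = Layer-resp j (∙-congˡ (⁻¹-cong u≈v)) (∼-refl j {u})

  ∼-∙ʳ : ∀ j {u v} w → u ∼[ j ] v → (u ∙ w) ∼[ j ] (v ∙ w)
  ∼-∙ʳ j {u} {v} w u∼v = Layer-resp j (≈-sym (-‿cancelʳ u v w)) u∼v

  ∼-∙-Layer : ∀ j u {y} → Layer j y → (u ∙ y) ∼[ j ] u
  ∼-∙-Layer j u {y} y∈ = Layer-resp j (≈-sym (xy-x≈y u y)) y∈

  ∼-setoid : ℕ → Setoid _ _
  ∼-setoid j = record
    { Carrier = Config n m
    ; _≈_ = _∼[ j ]_
    ; isEquivalence = record
      { refl = λ {u} → ∼-refl j {u} ; sym = λ {u v} → ∼-sym j {u} {v} ; trans = λ {u v w} → ∼-trans j {u} {v} {w} }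
    }

  ▷◁ : ∀ s v → s ▷ (v ◁ s) ≈ v
  ▷◁ s v i = cong v (Perm.inverseʳ s)

  private
    precomposition-step : ∀ j v (f g : Fin n → Fin n) →
      Layer j ((v ∘ f) - v) → Layer j ((v ∘ g) - v) → (∀ {w} → Layer j w → Layer j (w ∘ g)) →
      Layer j ((v ∘ f ∘ g) - (v ∘ f))
    precomposition-step j v f g f∈ g∈ ∘g-closed =
      Layer-resp j (≈-trans (∙-congʳ (-‿trans (v ∘ f ∘ g) (v ∘ g) v)) (-‿cancelʳ (v ∘ f ∘ g) (v ∘ f) (v ⁻¹)))
        (Layer-- j (Layer-∙ j (∘g-closed {(v ∘ f) - v} f∈) g∈) f∈)

    ▷-difference : ∀ j → (∀ {s} → s ∈ S → ∀ {w} → Layer j w → Layer j (s ▷ w)) →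
      ∀ {s} → s ∈ S → ∀ {v} → Layer (suc j) v → (s ▷ v) ∼[ j ] v
    ▷-difference j Layer-▷ {s} s∈ {v} v∈ =
      Layer-resp j (≈-trans (⁻¹-anti-homo‿- (s ▷ (v ◁ s)) (s ▷ v)) (∙-congˡ (⁻¹-cong (▷◁ s v))))
        (Layer-▷ s∈ (Layer-⁻¹ j (All.lookup v∈ s∈)))

  Layer-invariant : ∀ j {s} → s ∈ S → ∀ {v} → Layer j v → Layer j (s ▷ v) × Layer j (v ◁ s)
  Layer-invariant zero    s∈ v∈ = (λ _ → v∈ _) , (λ _ → v∈ _)
  Layer-invariant (suc j) {s} s∈ {v} v∈ =
    All.tabulate (λ {t} t∈ → precomposition-step j v (s ⟨$⟩ˡ_) (t ⟨$⟩ʳ_)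
      (▷-difference j (λ s∈′ {w} → proj₁ ∘ IH s∈′ {w}) s∈ {v} v∈) (All.lookup v∈ t∈)
      (λ {w} → proj₂ ∘ IH t∈ {w})) ,
    All.tabulate (λ {t} t∈ → precomposition-step j v (s ⟨$⟩ʳ_) (t ⟨$⟩ʳ_)
      (All.lookup v∈ s∈) (All.lookup v∈ t∈) (λ {w} → proj₂ ∘ IH t∈ {w}))
    where IH = Layer-invariant j

  Layer-▷ : ∀ j {s} → s ∈ S → ∀ {v} → Layer j v → Layer j (s ▷ v)
  Layer-▷ j s∈ v∈ = proj₁ (Layer-invariant j s∈ v∈)

  Layer-◁ : ∀ j {s} → s ∈ S → ∀ {v} → Layer j v → Layer j (v ◁ s)
  Layer-◁ j s∈ v∈ = proj₂ (Layer-invariant j s∈ v∈)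

  ▷-∼ : ∀ j {s} → s ∈ S → ∀ {v} → Layer (suc j) v → (s ▷ v) ∼[ j ] v
  ▷-∼ j = ▷-difference j (Layer-▷ j)

  Layer-suc : ∀ j {v} → Layer j v → Layer (suc j) v
  Layer-suc j v∈ = All.tabulate λ s∈ → Layer-- j (Layer-◁ j s∈ v∈) v∈

  Layer-zero⇒ : ∀ j {v} → Layer 0 v → Layer j v
  Layer-zero⇒ zero    v∈ = v∈
  Layer-zero⇒ (suc j) v∈ = Layer-suc j (Layer-zero⇒ j v∈)

  run : Config n m → List (Move n m) → Adversary S → Config n m
  run c []       adv = c
  run c (y ∷ ys) adv = run (step m c y (proj₁ (adv 0))) ys (adv ∘ suc)

  after : List (Move n m) → Adversary S → Adversary S
  after []       adv = adv
  after (_ ∷ ys) adv = after ys (adv ∘ suc)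

  run-++ : ∀ c ys zs adv → run c (ys ++ zs) adv ≡ run (run c ys adv) zs (after ys adv)
  run-++ c []       zs adv = refl
  run-++ c (y ∷ ys) zs adv = run-++ _ ys zs (adv ∘ suc)

  Wins : Config n m → List (Move n m) → Adversary S → Set
  Wins c ys adv = Any (AllZero m) (configs m S c ys adv)

  Wins-++ˡ : ∀ {c} ys zs {adv} → Wins c ys adv → Wins c (ys ++ zs) adv
  Wins-++ˡ []       []      (here c≈ε) = here c≈ε
  Wins-++ˡ []       (_ ∷ _) (here c≈ε) = here c≈ε
  Wins-++ˡ (_ ∷ _)  zs      (here c≈ε) = here c≈ε
  Wins-++ˡ (_ ∷ ys) zs      (there w)  = there (Wins-++ˡ ys zs w)

  Wins-++ʳ : ∀ {c} ys zs {adv} → Wins (run c ys adv) zs (after ys adv) → Wins c (ys ++ zs) adv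
  Wins-++ʳ []       zs w = w
  Wins-++ʳ (_ ∷ ys) zs w = there (Wins-++ʳ ys zs w)

  -- modulo Layer j the adversary is invisible as long as the configuration stays in Layer (j + 1)
  run-∼ : ∀ j {ys} c adv → All (Layer j) ys → Layer (suc j) c →
          run c ys adv ∼[ j ] c × Layer (suc j) (run c ys adv)
  run-∼ j c adv []         c∈ = ∼-refl j , c∈
  run-∼ j {y ∷ ys} c adv (y∈ ∷ ys∈) c∈ =
    ∼-trans j {run c′ ys (adv ∘ suc)} {c′} {c} (proj₁ rest)
      (∼-trans j {c′} {c ∙ y} {c} (▷-∼ j g∈ {c ∙ y} cy∈) (∼-∙-Layer j c {y} y∈)) , proj₂ rest
    where
    g∈ = proj₂ (adv 0)
    c′ = step m c y (proj₁ (adv 0))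
    cy∈ : Layer (suc j) (c ∙ y)
    cy∈ = Layer-∙ (suc j) {c} {y} c∈ (Layer-suc j {y} y∈)
    rest : run c′ ys (adv ∘ suc) ∼[ j ] c′ × Layer (suc j) (run c′ ys (adv ∘ suc))
    rest = run-∼ j c′ (adv ∘ suc) ys∈ (Layer-▷ (suc j) g∈ {c ∙ y} cy∈)

  configurations : List (Config n m)
  configurations = map lookup (vectors (allFin m) n)

  ≈∈configurations : ∀ v → ∃ λ u → u ∈ configurations × u ≈ v
  ≈∈configurations v =
    lookup (tabulate v) , ∈-map⁺ lookup (∈-vectors⁺ (VecAll.tabulate⁺ λ i → ∈-allFin (v i))) , lookup∘tabulate v

  layer : ℕ → List (Config n m)
  layer j = filter (layer? j) configurations

  ≈∈layer : ∀ j {v} → Layer j v → Any (_≈ v) (layer j)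
  ≈∈layer j {v} v∈ = let u , u∈ , u≈v = ≈∈configurations v in
    lose (∈-filter⁺ (layer? j) u∈ (Layer-resp j (≈-sym u≈v) v∈)) u≈v

  block : Move n m → List (Move n m) → List (Move n m)
  block w σ = w ⁻¹ ∷ σ ++ w ∷ []

  strategy : ℕ → List (Move n m)
  strategy zero    = []
  strategy (suc j) = concatMap (λ w → block w (strategy j)) (layer (suc j))

  strategy⊆Layer : ∀ j → All (Layer j) (strategy j)
  strategy⊆Layer zero    = []
  strategy⊆Layer (suc j) = All.concat⁺ (All.map⁺ (All.map
    (λ {w} w∈ → Layer-⁻¹ (suc j) {w} w∈ ∷ All.++⁺ (All.map (λ {y} → Layer-suc j {y}) (strategy⊆Layer j)) (w∈ ∷ []))
    (All.all-filter (layer? (suc j)) configurations)))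

  module _ (j : ℕ) {σ : List (Move n m)} (σ⊆Layer : All (Layer j) σ) where

    block-∼ : ∀ {c w} adv → Layer (suc j) c → Layer (suc j) w →
              run c (block w σ) adv ∼[ j ] c × Layer (suc j) (run c (block w σ) adv)
    block-∼ {c} {w} adv c∈ w∈ = subst (λ d → d ∼[ j ] c × Layer (suc j) d) (sym (run-++ c₁ σ (w ∷ []) (adv ∘ suc)))
      (c₃∼c , Layer-▷ (suc j) g₃∈ {c₂ ∙ w} c₂w∈)
      where
      g₁∈ = proj₂ (adv 0)
      g₃ = proj₁ (after σ (adv ∘ suc) 0)
      g₃∈ = proj₂ (after σ (adv ∘ suc) 0)
      cw⁻¹∈ : Layer (suc j) (c ∙ w ⁻¹)
      cw⁻¹∈ = Layer-∙ (suc j) {c} {w ⁻¹} c∈ (Layer-⁻¹ (suc j) {w} w∈)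
      c₁ = step m c (w ⁻¹) (proj₁ (adv 0))
      c₂ = run c₁ σ (adv ∘ suc)
      c₂∼c₁,c₂∈ : c₂ ∼[ j ] c₁ × Layer (suc j) c₂
      c₂∼c₁,c₂∈ = run-∼ j c₁ (adv ∘ suc) σ⊆Layer (Layer-▷ (suc j) g₁∈ {c ∙ w ⁻¹} cw⁻¹∈)
      c₂w∈ : Layer (suc j) (c₂ ∙ w)
      c₂w∈ = Layer-∙ (suc j) {c₂} {w} (proj₂ c₂∼c₁,c₂∈) w∈
      c₃∼c : step m c₂ w g₃ ∼[ j ] c
      c₃∼c = begin
        step m c₂ w g₃   ≈⟨ ▷-∼ j g₃∈ {c₂ ∙ w} c₂w∈ ⟩
        c₂ ∙ w           ≈⟨ ∼-∙ʳ j {c₂} {c₁} w (proj₁ c₂∼c₁,c₂∈) ⟩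
        c₁ ∙ w           ≈⟨ ∼-∙ʳ j {c₁} {c ∙ w ⁻¹} w (▷-∼ j g₁∈ {c ∙ w ⁻¹} cw⁻¹∈) ⟩
        (c ∙ w ⁻¹) ∙ w   ≈⟨ ≈⇒∼ j {(c ∙ w ⁻¹) ∙ w} {c} (//-rightDividesˡ w c) ⟩
        c                ∎
        where open SetoidReasoning (∼-setoid j)

    blocks-win : (∀ x → Layer j x → ∀ adv → Wins x σ adv) →
      ∀ {ws} c {x} adv → All (Layer (suc j)) ws → Any (_≈ x) ws → Layer (suc j) c → c ∼[ j ] x →
      Wins c (concatMap (λ w → block w σ) ws) adv
    blocks-win σ-wins {w ∷ ws} c {x} adv (w∈ ∷ _) (here w≈x) c∈ c∼x =
      there (Wins-++ˡ (σ ++ w ∷ []) _ (Wins-++ˡ σ (w ∷ []) (σ-wins _ c₁∈ (adv ∘ suc))))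
      where
      c₁∈ : Layer j (step m c (w ⁻¹) (proj₁ (adv 0)))
      c₁∈ = Layer-▷ j (proj₂ (adv 0)) {c ∙ w ⁻¹} (Layer-resp j {c - x} (∙-congˡ (⁻¹-cong (≈-sym w≈x))) c∼x)
    blocks-win σ-wins {w ∷ ws} c {x} adv (w∈ ∷ ws∈) (there x∈ws) c∈ c∼x =
      Wins-++ʳ {c} (block w σ) _ {adv} (blocks-win σ-wins c′ (after (block w σ) adv) ws∈ x∈ws
        (proj₂ c′∼c,c′∈) (∼-trans j {c′} {c} {x} (proj₁ c′∼c,c′∈) c∼x))
      where
      c′ = run c (block w σ) adv
      c′∼c,c′∈ : c′ ∼[ j ] c × Layer (suc j) c′
      c′∼c,c′∈ = block-∼ {c} {w} adv c∈ w∈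

  strategy-wins : ∀ j x → Layer j x → ∀ adv → Wins x (strategy j) adv
  strategy-wins zero    x x∈ adv = here x∈
  strategy-wins (suc j) x x∈ adv =
    blocks-win j (strategy⊆Layer j) (strategy-wins j) x adv
      (All.all-filter (layer? (suc j)) configurations) (≈∈layer (suc j) {x} x∈) x∈ (∼-refl j {x})

  Nilpotent : Set
  Nilpotent = ∃ λ N → ∀ v → Layer N v

  nilpotent⇒canWin : Nilpotent → CanWin S m
  nilpotent⇒canWin (N , all∈) = strategy N , λ x adv → strategy-wins N x (all∈ x) adv

  ¬Layer⇒¬AllZero : ∀ j {x} → ¬ Layer j x → ¬ AllZero m x
  ¬Layer⇒¬AllZero j x∉ x≈ε = x∉ (Layer-zero⇒ j x≈ε)

  Survives : Config n m → List (Move n m) → Adversary S → Set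
  Survives c ys adv = All (λ d → ¬ AllZero m d) (configs m S c ys adv)

  Survives-resp : ∀ {c c′} ys adv → c ≈ c′ → Survives c ys adv → Survives c′ ys adv
  Survives-resp []       adv c≈c′ (c≉ε ∷ [])   = (λ c′≈ε → c≉ε (≈-trans c≈c′ c′≈ε)) ∷ []
  Survives-resp (y ∷ ys) adv c≈c′ (c≉ε ∷ rest) =
    (λ c′≈ε → c≉ε (≈-trans c≈c′ c′≈ε)) ∷
    Survives-resp ys (adv ∘ suc) (λ i → ∙-congʳ {y} c≈c′ (proj₁ (adv 0) ⟨$⟩ˡ i)) rest

  module _ {e} (e∈S : e ∈ S) (e-id : IsIdentity e) where

    e▷ : ∀ v → e ▷ v ≈ v
    e▷ v i = cong v (trans (sym (e-id (e ⟨$⟩ˡ i))) (Perm.inverseʳ e))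

    -- one of the two predecessors x₁ - y (under e) and (x₁ ◁ s) - y (under s) lies outside Layer j
    retreat : ∀ j {x₁} → ¬ Layer (suc j) x₁ → ∀ y →
      ∃ λ x₀ → ∃ λ (g : Σ _ (_∈ S)) → ¬ Layer j x₀ × step m x₀ y (proj₁ g) ≈ x₁
    retreat j {x₁} x₁∉ y with find (¬All⇒Any¬ (λ s → layer? j ((x₁ ◁ s) - x₁)) S x₁∉) | layer? j (x₁ - y)
    ... | _ | no x₁-y∉ =
      x₁ - y , (e , e∈S) , x₁-y∉ , ≈-trans (e▷ ((x₁ - y) ∙ y)) (//-rightDividesˡ y x₁)
    ... | s , s∈ , x₁◁s-x₁∉ | yes x₁-y∈ =
      (x₁ ◁ s) - y , (s , s∈) , x₀∉ , ≈-trans (λ i → //-rightDividesˡ y (x₁ ◁ s) (s ⟨$⟩ˡ i)) (▷◁ s x₁)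
      where
      x₀∉ : ¬ Layer j ((x₁ ◁ s) - y)
      x₀∉ x₀∈ = x₁◁s-x₁∉ (Layer-resp j (-‿cancelʳ (x₁ ◁ s) x₁ (y ⁻¹)) (Layer-- j x₀∈ x₁-y∈))

    survives : ∀ ys j {d} → ¬ Layer (j + length ys) d → ∃ λ x → ∃ λ adv → ¬ Layer j x × Survives x ys adv
    survives [] j {d} d∉ = d , (λ _ → e , e∈S) , d∉′ , ¬Layer⇒¬AllZero j d∉′ ∷ []
      where d∉′ = subst (λ k → ¬ Layer k d) (+-identityʳ j) d∉
    survives (y ∷ ys) j {d} d∉ with survives ys (suc j) {d} (subst (λ k → ¬ Layer k d) (+-suc j (length ys)) d∉)
    ... | x₁ , adv , x₁∉ , x₁-survives with retreat j x₁∉ y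
    ...   | x₀ , g , x₀∉ , step≈x₁ =
      x₀ , adv′ , x₀∉ , ¬Layer⇒¬AllZero j x₀∉ ∷ Survives-resp ys adv (≈-sym step≈x₁) x₁-survives
      where
      adv′ : Adversary S
      adv′ zero    = g
      adv′ (suc k) = adv k

    canWin⇒nilpotent : CanWin S m → Nilpotent
    canWin⇒nilpotent (ys , wins) = length ys , λ v → decidable-stable (layer? (length ys) v) λ v∉ →
      let x , adv , _ , x-survives = survives ys 0 v∉ in All¬⇒¬Any x-survives (wins x adv)

lookup-ext : ∀ {A : Set} {k} {u v : Vec A k} → (∀ i → lookup u i ≡ lookup v i) → u ≡ v
lookup-ext {u = u} {v} u≗v = trans (sym (tabulate∘lookup u)) (trans (tabulate-cong u≗v) (tabulate∘lookup v))

_≟ᵛ_ : ∀ {k l} → DecidableEquality (Vec (Fin k) l)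
_≟ᵛ_ = Vec.≡-dec Fin._≟_

Table : ℕ → Set
Table n = Vec (Fin n) n

module _ {n : ℕ} where

  infixl 7 _⊙_
  _⊙_ : Table n → Table n → Table n
  v ⊙ w = tabulate (λ i → lookup v (lookup w i))

  idTable : Table n
  idTable = tabulate (λ i → i)

  lookup-⊙ : ∀ v w i → lookup (v ⊙ w) i ≡ lookup v (lookup w i)
  lookup-⊙ v w = lookup∘tabulate _

  lookup-id : ∀ i → lookup idTable i ≡ i
  lookup-id = lookup∘tabulate _

  ⊙-assoc : ∀ u v w → (u ⊙ v) ⊙ w ≡ u ⊙ (v ⊙ w)
  ⊙-assoc u v w = lookup-ext λ i → begin
    lookup ((u ⊙ v) ⊙ w) i          ≡⟨ lookup-⊙ (u ⊙ v) w i ⟩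
    lookup (u ⊙ v) (lookup w i)     ≡⟨ lookup-⊙ u v (lookup w i) ⟩
    lookup u (lookup v (lookup w i)) ≡⟨ cong (lookup u) (lookup-⊙ v w i) ⟨
    lookup u (lookup (v ⊙ w) i)     ≡⟨ lookup-⊙ u (v ⊙ w) i ⟨
    lookup (u ⊙ (v ⊙ w)) i          ∎
    where open ≡-Reasoning

  ⊙-identityˡ : ∀ v → idTable ⊙ v ≡ v
  ⊙-identityˡ v = lookup-ext λ i → trans (lookup-⊙ idTable v i) (lookup-id _)

  ⊙-identityʳ : ∀ v → v ⊙ idTable ≡ v
  ⊙-identityʳ v = lookup-ext λ i → trans (lookup-⊙ v idTable i) (cong (lookup v) (lookup-id i))

  tableˡ : Permutation′ n → Table n
  tableˡ g = tabulate (g ⟨$⟩ˡ_)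

  tabulate-∘ : ∀ (f : Fin n → Fin n) v → tabulate (λ i → f (lookup v i)) ≡ tabulate f ⊙ v
  tabulate-∘ f v = tabulate-cong λ i → sym (lookup∘tabulate f (lookup v i))

  tabulate-∘-⊙ : ∀ (f : Fin n → Fin n) v w →
    tabulate (λ i → f (lookup (v ⊙ w) i)) ≡ tabulate (λ i → f (lookup v i)) ⊙ w
  tabulate-∘-⊙ f v w = begin
    tabulate (λ i → f (lookup (v ⊙ w) i))    ≡⟨ tabulate-∘ f (v ⊙ w) ⟩
    tabulate f ⊙ (v ⊙ w)                    ≡⟨ ⊙-assoc (tabulate f) v w ⟨
    (tabulate f ⊙ v) ⊙ w                    ≡⟨ cong (_⊙ w) (tabulate-∘ f v) ⟨
    tabulate (λ i → f (lookup v i)) ⊙ w     ∎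
    where open ≡-Reasoning

  ⊙-tabulate-inverse : ∀ {f g : Fin n → Fin n} → (∀ i → f (g i) ≡ i) → tabulate f ⊙ tabulate g ≡ idTable
  ⊙-tabulate-inverse {f} {g} f∘g≗id = tabulate-cong λ i →
    trans (trans (lookup∘tabulate f _) (cong f (lookup∘tabulate g i))) (f∘g≗id i)

  _InverseOf_ : Table n → Table n → Set
  w InverseOf v = w ⊙ v ≡ idTable × v ⊙ w ≡ idTable

  ⊙-InverseOf : ∀ {a a′ v w} → a′ InverseOf a → w InverseOf v → (w ⊙ a′) InverseOf (a ⊙ v)
  ⊙-InverseOf {a} {a′} {v} {w} (a′a≡id , aa′≡id) (wv≡id , vw≡id) =
    cancel w a′ a v a′a≡id wv≡id , cancel a v w a′ vw≡id aa′≡id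
    where
    cancel : ∀ x y z t → y ⊙ z ≡ idTable → x ⊙ t ≡ idTable → (x ⊙ y) ⊙ (z ⊙ t) ≡ idTable
    cancel x y z t yz≡id xt≡id = begin
      (x ⊙ y) ⊙ (z ⊙ t)   ≡⟨ ⊙-assoc x y (z ⊙ t) ⟩
      x ⊙ (y ⊙ (z ⊙ t))   ≡⟨ cong (x ⊙_) (⊙-assoc y z t) ⟨
      x ⊙ ((y ⊙ z) ⊙ t)   ≡⟨ cong (λ u → x ⊙ (u ⊙ t)) yz≡id ⟩
      x ⊙ (idTable ⊙ t)   ≡⟨ cong (x ⊙_) (⊙-identityˡ t) ⟩
      x ⊙ t               ≡⟨ xt≡id ⟩
      idTable             ∎
      where open ≡-Reasoning

  module _ {S : List (Permutation′ n)} {G : List (Table n)} (G⇔ : ∀ v → (v ∈ G) ⇔ InGen S v) where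

    InGen⇒∈ : ∀ {v} → InGen S v → v ∈ G
    InGen⇒∈ {v} = Equivalence.from (G⇔ v)

    ∈⇒InGen : ∀ {v} → v ∈ G → InGen S v
    ∈⇒InGen {v} = Equivalence.to (G⇔ v)

  module _ (S : List (Permutation′ n)) where

    InGen-⊙ : ∀ {v w} → InGen S v → InGen S w → InGen S (v ⊙ w)
    InGen-⊙ {w = w} gen-id                gw = subst (InGen S) (sym (⊙-identityˡ w)) gw
    InGen-⊙ {w = w} (gen-mul {v} g g∈ gv) gw =
      subst (InGen S) (tabulate-∘-⊙ (g ⟨$⟩ʳ_) v w) (gen-mul g g∈ (InGen-⊙ gv gw))
    InGen-⊙ {w = w} (gen-inv {v} g g∈ gv) gw =
      subst (InGen S) (tabulate-∘-⊙ (g ⟨$⟩ˡ_) v w) (gen-inv g g∈ (InGen-⊙ gv gw))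

    InGen-table : ∀ {g} → g ∈ S → InGen S (table g)
    InGen-table {g} g∈ = subst (InGen S) (tabulate-cong λ i → cong (g ⟨$⟩ʳ_) (lookup-id i)) (gen-mul g g∈ gen-id)

    InGen-tableˡ : ∀ {g} → g ∈ S → InGen S (tableˡ g)
    InGen-tableˡ {g} g∈ = subst (InGen S) (tabulate-cong λ i → cong (g ⟨$⟩ˡ_) (lookup-id i)) (gen-inv g g∈ gen-id)

    private
      InverseOf-step : ∀ {f g : Fin n → Fin n} {v w} → (∀ i → f (g i) ≡ i) → (∀ i → g (f i) ≡ i) →
        InGen S (tabulate g) → InGen S w → w InverseOf v →
        ∃ λ w′ → InGen S w′ × w′ InverseOf tabulate (λ i → f (lookup v i))
      InverseOf-step {f} {g} {v} {w} f∘g≗id g∘f≗id gen-g gen-w w⁻¹ =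
        w ⊙ tabulate g , InGen-⊙ gen-w gen-g ,
        subst (λ u → (w ⊙ tabulate g) InverseOf u) (sym (tabulate-∘ f v))
          (⊙-InverseOf {tabulate f} {tabulate g} {v} {w} (⊙-tabulate-inverse g∘f≗id , ⊙-tabulate-inverse f∘g≗id) w⁻¹)

    InGen-inverse : ∀ {v} → InGen S v → ∃ λ w → InGen S w × w InverseOf v
    InGen-inverse gen-id = idTable , gen-id , ⊙-identityʳ idTable , ⊙-identityʳ idTable
    InGen-inverse (gen-mul {v} g g∈ gv) = let _ , gen-w , w⁻¹ = InGen-inverse gv in
      InverseOf-step {v = v} (λ _ → Perm.inverseʳ g) (λ _ → Perm.inverseˡ g) (InGen-tableˡ g∈) gen-w w⁻¹
    InGen-inverse (gen-inv {v} g g∈ gv) = let _ , gen-w , w⁻¹ = InGen-inverse gv in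
      InverseOf-step {v = v} (λ _ → Perm.inverseˡ g) (λ _ → Perm.inverseʳ g) (InGen-table g∈) gen-w w⁻¹

module LayerGenerated {n : ℕ} (m : ℕ) .{{_ : NonZero m}} (S : List (Permutation′ n)) where

  open Game m S

  _◁ᵗ_ : Config n m → Table n → Config n m
  (v ◁ᵗ w) i = v (lookup w i)

  ◁ᵗ-tabulate : ∀ v f w → (v ◁ᵗ tabulate (λ i → f (lookup w i))) ≈ ((v ∘ f) ◁ᵗ w)
  ◁ᵗ-tabulate v f w i = cong v (lookup∘tabulate _ i)

  Layer-◁ᵗ : ∀ j {w} → InGen S w → ∀ {v} → Layer j v → Layer j (v ◁ᵗ w)
  Layer-◁ᵗ j gen-id {v} v∈ = Layer-resp j (λ i → cong v (sym (lookup-id i))) v∈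
  Layer-◁ᵗ j (gen-mul {w} g g∈ gw) {v} v∈ =
    Layer-resp j (≈-sym (◁ᵗ-tabulate v (g ⟨$⟩ʳ_) w)) (Layer-◁ᵗ j gw (Layer-◁ j g∈ v∈))
  Layer-◁ᵗ j (gen-inv {w} g g∈ gw) {v} v∈ =
    Layer-resp j (≈-sym (◁ᵗ-tabulate v (g ⟨$⟩ˡ_) w)) (Layer-◁ᵗ j gw (Layer-▷ j g∈ v∈))

  ◁ᵗ-∼ : ∀ j {w} → InGen S w → ∀ {v} → Layer (suc j) v → (v ◁ᵗ w) ∼[ j ] v
  ◁ᵗ-∼ j gen-id {v} v∈ = ≈⇒∼ j (λ i → cong v (lookup-id i))
  ◁ᵗ-∼ j (gen-mul {w} g g∈ gw) {v} v∈ =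
    Layer-resp j (≈-trans (-‿trans ((v ◁ g) ◁ᵗ w) (v ◁ᵗ w) v) (∙-congʳ (≈-sym (◁ᵗ-tabulate v (g ⟨$⟩ʳ_) w))))
      (Layer-∙ j {((v ◁ g) - v) ◁ᵗ w} {(v ◁ᵗ w) - v}
        (Layer-◁ᵗ j gw {(v ◁ g) - v} (All.lookup v∈ g∈)) (◁ᵗ-∼ j gw {v} v∈))
  ◁ᵗ-∼ j (gen-inv {w} g g∈ gw) {v} v∈ =
    Layer-resp j (≈-trans (-‿trans ((g ▷ v) ◁ᵗ w) (v ◁ᵗ w) v) (∙-congʳ (≈-sym (◁ᵗ-tabulate v (g ⟨$⟩ˡ_) w))))
      (Layer-∙ j {((g ▷ v) - v) ◁ᵗ w} {(v ◁ᵗ w) - v}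
        (Layer-◁ᵗ j gw {(g ▷ v) - v} (▷-∼ j g∈ {v} v∈)) (◁ᵗ-∼ j gw {v} v∈))

-- Prime-power order and modulus

module Sufficiency {n : ℕ} (m : ℕ) .{{_ : NonZero m}} (S : List (Permutation′ n))
  (G : List (Table n)) (G! : Unique G) (G⇔ : ∀ v → (v ∈ G) ⇔ InGen S v)
  {p a b : ℕ} (pp : Prime p) (|G|≡p^a : length G ≡ p ^ a) (m≡p^b : m ≡ p ^ b) where

  open Game m S
  open LayerGenerated m S

  ConfigVec : Set
  ConfigVec = Vec (ℤ_ m) n

  vecs : List ConfigVec
  vecs = vectors (allFin m) n

  ∈-vecs : ∀ u → u ∈ vecs
  ∈-vecs u = ∈-vectors⁺ (VecAll.universal ∈-allFin u)

  vecs! : Unique vecs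
  vecs! = vectors-unique n (Unique.allFin⁺ m)

  length-vecs : length vecs ≡ p ^ (b * n)
  length-vecs = trans (length-vectors (allFin m) n)
    (trans (cong (_^ n) (trans (length-tabulate (λ i → i)) m≡p^b)) (^-*-assoc p b n))

  0v : ConfigVec
  0v = tabulate (λ _ → 0ₘ m)

  module Quotient (j : ℕ) where

    _≈ⱼ_ : ConfigVec → ConfigVec → Set
    u ≈ⱼ v = lookup u ∼[ j ] lookup v

    rep : ConfigVec → ConfigVec
    rep u = pick (λ u′ → layer? j (lookup u′ - lookup u)) vecs 0v

    rep≈ⱼ : ∀ u → rep u ≈ⱼ u
    rep≈ⱼ u = proj₂ (pick-spec (λ u′ → layer? j (lookup u′ - lookup u)) 0v (lose (∈-vecs u) (∼-refl j {lookup u})))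

    rep-cong : ∀ {u v} → u ≈ⱼ v → rep u ≡ rep v
    rep-cong {u} {v} u≈v = pick-cong (λ w → layer? j (lookup w - lookup u)) (λ w → layer? j (lookup w - lookup v))
      (λ {w} w≈u → ∼-trans j {lookup w} {lookup u} {lookup v} w≈u u≈v)
      (λ {w} w≈v → ∼-trans j {lookup w} {lookup v} {lookup u} w≈v (∼-sym j {lookup u} {lookup v} u≈v)) vecs 0v

    reps : List ConfigVec
    reps = filter (λ u → rep u ≟ᵛ u) vecs

    rep∈reps : ∀ u → rep u ∈ reps
    rep∈reps u = ∈-filter⁺ (λ u → rep u ≟ᵛ u) (∈-vecs (rep u)) (rep-cong {rep u} {u} (rep≈ⱼ u))

    rep-of-rep : ∀ {u} → u ∈ reps → rep u ≡ u
    rep-of-rep {u} u∈ = proj₂ (∈-filter⁻ (λ u → rep u ≟ᵛ u) {xs = vecs} u∈)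

    layerVecs : List ConfigVec
    layerVecs = filter (λ u → layer? j (lookup u)) vecs

    -- u ↦ (rep u , u - rep u) identifies ℤₘⁿ with reps × Layer j
    length-vecs≡reps*layer : length vecs ≡ length reps * length layerVecs
    length-vecs≡reps*layer = trans
      (≤-antisym (injective⇒length-≤ split vecs! (λ {u} _ → split∈ {u}) split-injective)
                 (injective⇒length-≤ join pairs! (λ _ → ∈-vecs _) join-injective))
      (length-cartesianProductWith _,_ reps layerVecs)
      where
      split : ConfigVec → ConfigVec × ConfigVec
      split u = rep u , tabulate (lookup u - lookup (rep u))
      join : ConfigVec × ConfigVec → ConfigVec
      join (r , d) = tabulate (lookup r ∙ lookup d)
      pairs! = Unique.cartesianProduct⁺ (Unique.filter⁺ _ vecs!) (Unique.filter⁺ _ vecs!)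
      split∈ : ∀ {u} → split u ∈ cartesianProduct reps layerVecs
      split∈ {u} = ∈-cartesianProduct⁺ (rep∈reps u) (∈-filter⁺ _ (∈-vecs _)
        (Layer-resp j (λ i → sym (lookup∘tabulate _ i)) (∼-sym j {lookup (rep u)} (rep≈ⱼ u))))
      lookup-tabulate-≡ : ∀ {f g : Config n m} → tabulate f ≡ tabulate g → f ≈ g
      lookup-tabulate-≡ {f} {g} eq i = trans (sym (lookup∘tabulate f i)) (trans (cong (λ w → lookup w i) eq) (lookup∘tabulate g i))

      split-injective : ∀ {u v} → u ∈ vecs → v ∈ vecs → split u ≡ split v → u ≡ v
      split-injective {u} {v} _ _ eq = lookup-ext (≈-trans (≈-sym (//-rightDividesˡ (lookup (rep u)) (lookup u)))
        (≈-trans (∙-cong (lookup-tabulate-≡ (,-injectiveʳ eq)) (λ i → cong (λ w → lookup w i) (,-injectiveˡ eq)))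
                 (//-rightDividesˡ (lookup (rep v)) (lookup v))))

      join-injective : ∀ {q q′} → q ∈ cartesianProduct reps layerVecs → q′ ∈ cartesianProduct reps layerVecs →
                       join q ≡ join q′ → q ≡ q′
      join-injective {r , d} {r′ , d′} q∈ q′∈ eq = cong₂ _,_ r≡r′ (lookup-ext (∙-cancelˡ (lookup r) (lookup d) (lookup d′)
        (≈-trans rd≈r′d′ (∙-congʳ (λ i → cong (λ w → lookup w i) (sym r≡r′))))))
        where
        r∈,d∈ = ∈-cartesianProduct⁻ reps layerVecs q∈
        r′∈,d′∈ = ∈-cartesianProduct⁻ reps layerVecs q′∈
        rd≈r′d′ : (lookup r ∙ lookup d) ≈ (lookup r′ ∙ lookup d′)
        rd≈r′d′ = lookup-tabulate-≡ eq
        r≈ⱼr′ : r ≈ⱼ r′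
        r≈ⱼr′ = Layer-resp j {lookup d′ - lookup d}
          (≈-sym (∙-≈⇒-‿≈ (lookup r) (lookup d) (lookup r′) (lookup d′) rd≈r′d′))
          (Layer-- j (proj₂ (∈-filter⁻ _ {xs = vecs} (proj₂ r′∈,d′∈)))
                     (proj₂ (∈-filter⁻ _ {xs = vecs} (proj₂ r∈,d∈))))
        r≡r′ : r ≡ r′
        r≡r′ = trans (sym (rep-of-rep (proj₁ r∈,d∈))) (trans (rep-cong {r} {r′} r≈ⱼr′) (rep-of-rep (proj₁ r′∈,d′∈)))

    _·_ : Table n → ConfigVec → ConfigVec
    w · u = rep (tabulate (lookup u ◁ᵗ w))

    lookup-◁ᵗ : ∀ u w → lookup (tabulate (lookup u ◁ᵗ w)) ≈ (lookup u ◁ᵗ w)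
    lookup-◁ᵗ u w = lookup∘tabulate (lookup u ◁ᵗ w)

    ◁ᵗ-≈ⱼ : ∀ {w} → w ∈ G → ∀ {u v} → u ≈ⱼ v → tabulate (lookup u ◁ᵗ w) ≈ⱼ tabulate (lookup v ◁ᵗ w)
    ◁ᵗ-≈ⱼ {w} w∈ {u} {v} u≈v = Layer-resp j (≈-sym (//-cong₂ (lookup-◁ᵗ u w) (lookup-◁ᵗ v w)))
      (Layer-◁ᵗ j (∈⇒InGen G⇔ w∈) {lookup u - lookup v} u≈v)

    ·-identity : ∀ {u} → rep u ≡ u → idTable · u ≡ u
    ·-identity {u} ru≡u = trans (cong rep (lookup-ext {u = tabulate (lookup u ◁ᵗ idTable)} {u} λ i →
      trans (lookup-◁ᵗ u idTable i) (cong (lookup u) (lookup-id i)))) ru≡u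

    ·-⊙ : ∀ {v w} → v ∈ G → w ∈ G → ∀ {u} → rep u ≡ u → (v ⊙ w) · u ≡ w · (v · u)
    ·-⊙ {v} {w} _ w∈ {u} _ = trans
      (cong rep (lookup-ext {u = tabulate (lookup u ◁ᵗ (v ⊙ w))} {tabulate (lookup (tabulate (lookup u ◁ᵗ v)) ◁ᵗ w)} λ i → begin
        lookup (tabulate (lookup u ◁ᵗ (v ⊙ w))) i       ≡⟨ lookup-◁ᵗ u (v ⊙ w) i ⟩
        lookup u (lookup (v ⊙ w) i)                      ≡⟨ cong (lookup u) (lookup-⊙ v w i) ⟩
        lookup u (lookup v (lookup w i))                 ≡⟨ lookup-◁ᵗ u v (lookup w i) ⟨
        lookup (tabulate (lookup u ◁ᵗ v)) (lookup w i)   ≡⟨ lookup-◁ᵗ (tabulate (lookup u ◁ᵗ v)) w i ⟨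
        lookup (tabulate (lookup (tabulate (lookup u ◁ᵗ v)) ◁ᵗ w)) i ∎))
      (rep-cong {tabulate (lookup (tabulate (lookup u ◁ᵗ v)) ◁ᵗ w)} {tabulate (lookup (v · u) ◁ᵗ w)}
        (◁ᵗ-≈ⱼ w∈ {tabulate (lookup u ◁ᵗ v)} {v · u} (∼-sym j {lookup (v · u)} (rep≈ⱼ (tabulate (lookup u ◁ᵗ v))))))
      where open ≡-Reasoning

    inverse∈G : ∀ {v} → v ∈ G → Any (λ w → w ⊙ v ≡ idTable × v ⊙ w ≡ idTable) G
    inverse∈G v∈ = let w , gw , w⁻¹ = InGen-inverse S (∈⇒InGen G⇔ v∈) in lose (InGen⇒∈ G⇔ gw) w⁻¹

    open FiniteGroupAction _≟ᵛ_ _≟ᵛ_ _⊙_ idTable G G! (InGen⇒∈ G⇔ gen-id)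
      (λ v∈ w∈ → InGen⇒∈ G⇔ (InGen-⊙ S (∈⇒InGen G⇔ v∈) (∈⇒InGen G⇔ w∈)))
      inverse∈G ⊙-assoc ⊙-identityˡ ⊙-identityʳ
      _·_ (λ u → rep u ≡ u) ·-identity ·-⊙
      using (Closed; Fixed; fixed?; fixedIn; ℓ∣fixedIn)

    reps-closed : Closed reps
    reps-closed = (λ {u} {h} _ _ → rep∈reps (tabulate (lookup u ◁ᵗ h))) , rep-of-rep

    rep0-fixed : Fixed (rep 0v)
    rep0-fixed = All.tabulate λ {w} w∈ → rep-cong {tabulate (lookup (rep 0v) ◁ᵗ w)} {0v}
      (∼-trans j {lookup (tabulate (lookup (rep 0v) ◁ᵗ w))} {lookup (tabulate (lookup 0v ◁ᵗ w))} {lookup 0v}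
        (◁ᵗ-≈ⱼ w∈ {rep 0v} {0v} (rep≈ⱼ 0v))
        (≈⇒∼ j λ i → trans (lookup-◁ᵗ 0v w i)
          (trans (lookup∘tabulate (λ _ → 0ₘ m) (lookup w i)) (sym (lookup∘tabulate (λ _ → 0ₘ m) i)))))

    fixed⇒Layer-suc : ∀ {u} → Fixed u → Layer (suc j) (lookup u)
    fixed⇒Layer-suc {u} u-fixed = All.tabulate λ {s} s∈ →
      let h∈ = InGen⇒∈ G⇔ (InGen-table S s∈) in
      Layer-resp j {lookup (tabulate (lookup u ◁ᵗ table s)) - lookup u}
        (//-cong₂ (λ i → trans (lookup-◁ᵗ u (table s) i) (cong (lookup u) (lookup∘tabulate _ i))) (≈-refl {lookup u}))
        (subst (tabulate (lookup u ◁ᵗ table s) ≈ⱼ_) (All.lookup u-fixed h∈)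
          (∼-sym j {lookup (table s · u)} (rep≈ⱼ (tabulate (lookup u ◁ᵗ table s)))))

    ≢rep0⇒¬Layer : ∀ {u} → u ∈ reps → u ≢ rep 0v → ¬ Layer j (lookup u)
    ≢rep0⇒¬Layer {u} u∈ u≢ u∈Layer = u≢ (trans (sym (rep-of-rep u∈)) (rep-cong {u} {0v}
      (Layer-resp j (≈-sym (≈-trans (//-cong₂ ≈-refl (lookup∘tabulate _)) (-‿identityʳ (lookup u)))) u∈Layer)))

    grows : ∀ {v₀} → ¬ Layer j v₀ → ∃ λ u → Layer (suc j) (lookup u) × ¬ Layer j (lookup u)
    grows {v₀} v₀∉ =
      let u , u∈ , u≢rep0 = prime∣length⇒∃≢ _≟ᵛ_ pp (Unique.filter⁺ fixed? reps!) p∣fixed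
                              (∈-filter⁺ fixed? (rep∈reps 0v) rep0-fixed)
          u∈reps , u-fixed = ∈-filter⁻ fixed? {xs = reps} u∈
      in u , fixed⇒Layer-suc u-fixed , ≢rep0⇒¬Layer u∈reps u≢rep0
      where
      reps! : Unique reps
      reps! = Unique.filter⁺ _ vecs!
      reps≢1 : length reps ≢ 1
      reps≢1 |reps|≡1 = v₀∉ (Layer-resp j (≈-trans (//-cong₂ (lookup∘tabulate v₀) (lookup∘tabulate _)) (-‿identityʳ v₀))
        (∼-trans j {lookup (tabulate v₀)} {lookup (rep (tabulate v₀))} {lookup 0v}
          (∼-sym j {lookup (rep (tabulate v₀))} (rep≈ⱼ (tabulate v₀)))
          (subst (_≈ⱼ 0v) (sym (∈-length≡1⇒≡ |reps|≡1 (rep∈reps (tabulate v₀)) (rep∈reps 0v))) (rep≈ⱼ 0v))))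
      p∣reps : p ∣ length reps
      p∣reps = ∣^∧≢1⇒∣ (b * n) pp
        (divides (length layerVecs) (trans (sym length-vecs) (trans length-vecs≡reps*layer (*-comm (length reps) _))))
        reps≢1
      p∣fixed : p ∣ length (fixedIn reps)
      p∣fixed = ℓ∣fixedIn {a = a} pp |G|≡p^a reps! reps-closed p∣reps

  Layer-grows : ∀ j → ¬ All (Layer j ∘ lookup) vecs → ∃ λ u → u ∈ vecs × Layer (suc j) (lookup u) × ¬ Layer j (lookup u)
  Layer-grows j ¬all =
    let v₀ , _ , v₀∉ = find (¬All⇒Any¬ (layer? j ∘ lookup) vecs ¬all)
        u , u∈ , u∉ = Quotient.grows j v₀∉
    in u , ∈-vecs u , u∈ , u∉

  nilpotent : Nilpotent
  nilpotent = _ , λ v → Layer-resp _ (lookup∘tabulate v) (All.lookup exhausted (∈-vecs (tabulate v)))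
    where
    exhausted = chain-exhausts (λ j u → Layer j (lookup u)) (λ j u → layer? j (lookup u)) vecs
                               (λ {j} {u} → Layer-suc j {lookup u}) Layer-grows

-- Cauchy's theorem

module _ {A : Set} where

  rotate : List A → List A
  rotate []       = []
  rotate (x ∷ xs) = xs ++ [ x ]

  rotate^ : ℕ → List A → List A
  rotate^ k xs = iterate rotate xs k

  rotate^-+ : ∀ a b xs → rotate^ (a + b) xs ≡ rotate^ b (rotate^ a xs)
  rotate^-+ zero    b xs = refl
  rotate^-+ (suc a) b xs = rotate^-+ a b (rotate xs)

  length-rotate : ∀ xs → length (rotate xs) ≡ length xs
  length-rotate []       = refl
  length-rotate (x ∷ xs) = trans (length-++ xs) (+-comm (length xs) 1)

  length-rotate^ : ∀ k xs → length (rotate^ k xs) ≡ length xs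
  length-rotate^ zero    xs = refl
  length-rotate^ (suc k) xs = trans (length-rotate^ k (rotate xs)) (length-rotate xs)

  rotate^-length-++ : ∀ xs ys → rotate^ (length xs) (xs ++ ys) ≡ ys ++ xs
  rotate^-length-++ []       ys = sym (++-identityʳ ys)
  rotate^-length-++ (x ∷ xs) ys = begin
    rotate^ (length xs) ((xs ++ ys) ++ [ x ])   ≡⟨ cong (rotate^ (length xs)) (++-assoc xs ys [ x ]) ⟩
    rotate^ (length xs) (xs ++ ys ++ [ x ])     ≡⟨ rotate^-length-++ xs (ys ++ [ x ]) ⟩
    (ys ++ [ x ]) ++ xs                         ≡⟨ ++-assoc ys [ x ] xs ⟩
    ys ++ x ∷ xs                                ∎
    where open ≡-Reasoning

  rotate^-length : ∀ xs → rotate^ (length xs) xs ≡ xs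
  rotate^-length xs = trans (cong (rotate^ (length xs)) (sym (++-identityʳ xs))) (rotate^-length-++ xs [])

  rotate^-% : ∀ q .{{_ : NonZero q}} k xs → length xs ≡ q → rotate^ (k % q) xs ≡ rotate^ k xs
  rotate^-% q k xs |xs|≡q = sym (begin
    rotate^ k xs                                 ≡⟨ cong (λ i → rotate^ i xs) (m≡m%n+[m/n]*n k q) ⟩
    rotate^ (k % q + (k / q) * q) xs             ≡⟨ rotate^-+ (k % q) _ xs ⟩
    rotate^ ((k / q) * q) (rotate^ (k % q) xs)   ≡⟨ rotate^-* (k / q) (trans (length-rotate^ (k % q) xs) |xs|≡q) ⟩
    rotate^ (k % q) xs                           ∎)
    where
    open ≡-Reasoning
    rotate^-* : ∀ c {ys} → length ys ≡ q → rotate^ (c * q) ys ≡ ys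
    rotate^-* zero    _     = refl
    rotate^-* (suc c) {ys} |ys|≡q = begin
      rotate^ (q + c * q) ys             ≡⟨ rotate^-+ q (c * q) ys ⟩
      rotate^ (c * q) (rotate^ q ys)     ≡⟨ cong (λ i → rotate^ (c * q) (rotate^ i ys)) (sym |ys|≡q) ⟩
      rotate^ (c * q) (rotate^ (length ys) ys) ≡⟨ cong (rotate^ (c * q)) (rotate^-length ys) ⟩
      rotate^ (c * q) ys                 ≡⟨ rotate^-* c |ys|≡q ⟩
      ys                                 ∎

  rotate-fixed⇒replicate : ∀ x xs → rotate (x ∷ xs) ≡ x ∷ xs → x ∷ xs ≡ replicate (suc (length xs)) x
  rotate-fixed⇒replicate x xs eq = cong (x ∷_) (go xs eq)
    where
    go : ∀ ys → ys ++ [ x ] ≡ x ∷ ys → ys ≡ replicate (length ys) x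
    go []       _  = refl
    go (y ∷ ys) eq with ∷-injective eq
    ... | refl , eq′ = cong (x ∷_) (go ys eq′)

  rotate^-replicate : ∀ k q (x : A) → rotate^ k (replicate q x) ≡ replicate q x
  rotate^-replicate zero    q x = refl
  rotate^-replicate (suc k) zero    x = rotate^-replicate k zero x
  rotate^-replicate (suc k) (suc q) x = trans (cong (rotate^ k) (snoc q)) (rotate^-replicate k (suc q) x)
    where
    snoc : ∀ q → replicate q x ++ [ x ] ≡ x ∷ replicate q x
    snoc zero    = refl
    snoc (suc q) = cong (x ∷_) (snoc q)

module Cauchy {n : ℕ} (S : List (Permutation′ n))
  (G : List (Table n)) (G! : Unique G) (G⇔ : ∀ v → (v ∈ G) ⇔ InGen S v)
  {q″ : ℕ} (qp : Prime (2 + q″)) (q∣|G| : 2 + q″ ∣ length G) where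

  q′ q : ℕ
  q′ = suc q″
  q = suc q′

  composition : List (Table n) → Table n
  composition = foldr _⊙_ idTable

  composition∈G : ∀ {t} → All (_∈ G) t → composition t ∈ G
  composition∈G []          = InGen⇒∈ G⇔ gen-id
  composition∈G (x∈ ∷ xs∈) = InGen⇒∈ G⇔ (InGen-⊙ S (∈⇒InGen G⇔ x∈) (∈⇒InGen G⇔ (composition∈G xs∈)))

  composition-++ : ∀ xs ys → composition (xs ++ ys) ≡ composition xs ⊙ composition ys
  composition-++ []       ys = sym (⊙-identityˡ (composition ys))
  composition-++ (x ∷ xs) ys = trans (cong (x ⊙_) (composition-++ xs ys)) (sym (⊙-assoc x (composition xs) (composition ys)))

  ⊙-cancelʳ : ∀ {a b c} → c ∈ G → a ⊙ c ≡ b ⊙ c → a ≡ b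
  ⊙-cancelʳ {a} {b} {c} c∈ eq with InGen-inverse S (∈⇒InGen G⇔ c∈)
  ... | c′ , _ , _ , cc′≡id = begin
    a                 ≡⟨ ⊙-identityʳ a ⟨
    a ⊙ idTable       ≡⟨ cong (a ⊙_) cc′≡id ⟨
    a ⊙ (c ⊙ c′)      ≡⟨ ⊙-assoc a c c′ ⟨
    (a ⊙ c) ⊙ c′      ≡⟨ cong (_⊙ c′) eq ⟩
    (b ⊙ c) ⊙ c′      ≡⟨ ⊙-assoc b c c′ ⟩
    b ⊙ (c ⊙ c′)      ≡⟨ cong (b ⊙_) cc′≡id ⟩
    b ⊙ idTable       ≡⟨ ⊙-identityʳ b ⟩
    b                 ∎
    where open ≡-Reasoning

  left-inverse⇒right-inverse : ∀ {x c} → c ∈ G → x ⊙ c ≡ idTable → c ⊙ x ≡ idTable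
  left-inverse⇒right-inverse {x} {c} c∈ xc≡id with InGen-inverse S (∈⇒InGen G⇔ c∈)
  ... | c′ , _ , c′c≡id , cc′≡id = trans (cong (c ⊙_) (⊙-cancelʳ {x} {c′} c∈ (trans xc≡id (sym c′c≡id)))) cc′≡id

  inverse : Table n → Table n
  inverse c = pick (λ w → (w ⊙ c) ≟ᵛ idTable) G idTable

  inverse-spec : ∀ {c} → c ∈ G → inverse c ∈ G × inverse c ⊙ c ≡ idTable
  inverse-spec {c} c∈ = pick-spec (λ w → (w ⊙ c) ≟ᵛ idTable) idTable
    (let w , gw , wc≡id , _ = InGen-inverse S (∈⇒InGen G⇔ c∈) in lose (InGen⇒∈ G⇔ gw) wc≡id)

  -- tuples (g₁, …, g_q) in G with g₁ ⋯ g_q = 1; the first entry is determined by the others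
  completeTuple : List (Table n) → List (Table n)
  completeTuple r = inverse (composition r) ∷ r

  tuples : List (List (Table n))
  tuples = map completeTuple (lists G q′)

  ∈-tuples⁻ : ∀ {t} → t ∈ tuples → length t ≡ q × All (_∈ G) t × composition t ≡ idTable
  ∈-tuples⁻ t∈ with ∈-map⁻ completeTuple t∈
  ... | r , r∈ , refl = let |r|≡q′ , r⊆G = ∈-lists⁻ G q′ r∈ ; inv∈ , inv-prod≡id = inverse-spec (composition∈G r⊆G)
                        in cong suc |r|≡q′ , inv∈ ∷ r⊆G , inv-prod≡id

  ∈-tuples⁺ : ∀ {t} → length t ≡ q → All (_∈ G) t → composition t ≡ idTable → t ∈ tuples
  ∈-tuples⁺ {x ∷ r} |t|≡q (x∈ ∷ r⊆G) xr≡id =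
    subst (_∈ tuples) (cong (_∷ r) (sym x≡inv)) (∈-map⁺ completeTuple (∈-lists⁺ q′ (cong Data.Nat.pred |t|≡q) r⊆G))
    where
    x≡inv : x ≡ inverse (composition r)
    x≡inv = ⊙-cancelʳ (composition∈G r⊆G) (trans xr≡id (sym (proj₂ (inverse-spec (composition∈G r⊆G)))))

  tuples! : Unique tuples
  tuples! = Unique.map⁺ ∷-injectiveʳ (lists-unique q′ G!)

  q∣|tuples| : q ∣ length tuples
  q∣|tuples| = subst (q ∣_) (sym (trans (length-map completeTuple (lists G q′)) (length-lists G q′)))
    (∣-trans q∣|G| (m∣m*n (length G ^ q″)))

  rotate-tuples : ∀ {t} → t ∈ tuples → rotate t ∈ tuples
  rotate-tuples {t} t∈ with ∈-tuples⁻ t∈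
  rotate-tuples {x ∷ xs} _ | |t|≡q , x∈ ∷ xs⊆G , xxs≡id =
    ∈-tuples⁺ (trans (length-rotate (x ∷ xs)) |t|≡q) (All.++⁺ xs⊆G (x∈ ∷ [])) (begin
      composition (xs ++ [ x ])      ≡⟨ composition-++ xs [ x ] ⟩
      composition xs ⊙ (x ⊙ idTable) ≡⟨ cong (composition xs ⊙_) (⊙-identityʳ x) ⟩
      composition xs ⊙ x             ≡⟨ left-inverse⇒right-inverse {x} (composition∈G xs⊆G) xxs≡id ⟩
      idTable                    ∎)
    where open ≡-Reasoning

  rotate^-tuples : ∀ k {t} → t ∈ tuples → rotate^ k t ∈ tuples
  rotate^-tuples zero    t∈ = t∈
  rotate^-tuples (suc k) t∈ = rotate^-tuples k (rotate-tuples t∈)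

  _·_ : ℤ_ q → List (Table n) → List (Table n)
  k · t = rotate^ (toℕ k) t

  ·-identity : ∀ {t} → length t ≡ q → 0ₘ q · t ≡ t
  ·-identity {t} _ = cong (λ i → rotate^ i t) (ℤₘ.toℕ-0ₘ q)

  ·-+ : ∀ {a b} → a ∈ allFin q → b ∈ allFin q → ∀ {t} → length t ≡ q → _+ₘ_ q a b · t ≡ b · (a · t)
  ·-+ {a} {b} _ _ {t} |t|≡q = begin
    rotate^ (toℕ ((toℕ a + toℕ b) mod q)) t    ≡⟨ cong (λ i → rotate^ i t) (ℤₘ.toℕ-mod q (toℕ a + toℕ b)) ⟩
    rotate^ ((toℕ a + toℕ b) % q) t            ≡⟨ rotate^-% q (toℕ a + toℕ b) t |t|≡q ⟩
    rotate^ (toℕ a + toℕ b) t                  ≡⟨ rotate^-+ (toℕ a) (toℕ b) t ⟩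
    rotate^ (toℕ b) (rotate^ (toℕ a) t)        ∎
    where open ≡-Reasoning

  open AbelianGroup (ℤₘ.abelianGroup q) using (assoc; identityˡ; identityʳ; inverseˡ; inverseʳ)

  open FiniteGroupAction Fin._≟_ (List.≡-dec _≟ᵛ_) (_+ₘ_ q) (0ₘ q) (allFin q) (Unique.allFin⁺ q) (∈-allFin _)
    (λ _ _ → ∈-allFin _) (λ {a} _ → lose (∈-allFin (ℤₘ.-ₘ_ q a)) (inverseˡ a , inverseʳ a)) assoc identityˡ identityʳ
    _·_ (λ t → length t ≡ q) ·-identity ·-+
    using (Closed; fixed?; fixedIn; ℓ∣fixedIn)

  tuples-closed : Closed tuples
  tuples-closed = (λ {_} {k} t∈ _ → rotate^-tuples (toℕ k) t∈) , (λ t∈ → proj₁ (∈-tuples⁻ t∈))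

  constantTuple : List (Table n)
  constantTuple = replicate q idTable

  constantTuple∈fixed : constantTuple ∈ fixedIn tuples
  constantTuple∈fixed = ∈-filter⁺ fixed?
    (∈-tuples⁺ (length-replicate q) (All.replicate⁺ q (InGen⇒∈ G⇔ gen-id)) (composition-id q))
    (All.tabulate λ {k} _ → rotate^-replicate (toℕ k) q idTable)
    where
    composition-id : ∀ k → composition (replicate k idTable) ≡ idTable
    composition-id zero    = refl
    composition-id (suc k) = trans (cong (idTable ⊙_) (composition-id k)) (⊙-identityˡ idTable)

  lookup-composition-replicate : ∀ k (g : Table n) x → lookup (composition (replicate k g)) x ≡ fold x (lookup g) k
  lookup-composition-replicate zero    g x = lookup-id x
  lookup-composition-replicate (suc k) g x =
    trans (lookup-⊙ g (composition (replicate k g)) x) (cong (lookup g) (lookup-composition-replicate k g x))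

  cauchy : ∃ λ g → g ∈ G × g ≢ idTable × (∀ x → fold x (lookup g) q ≡ x)
  cauchy with prime∣length⇒∃≢ (List.≡-dec _≟ᵛ_) qp (Unique.filter⁺ fixed? tuples!)
                (ℓ∣fixedIn {a = 1} qp (trans (length-tabulate (λ i → i)) (sym (*-identityʳ q))) tuples! tuples-closed q∣|tuples|)
                constantTuple∈fixed
  ... | t , t∈fixed , t≢const with ∈-filter⁻ fixed? {xs = tuples} t∈fixed
  ... | t∈ , t-fixed with ∈-tuples⁻ t∈
  cauchy | x ∷ xs , _ , t≢const | _ , t-fixed | |t|≡q , x∈ ∷ _ , t-composition =
    x , x∈ , (λ x≡id → t≢const (trans t≡x^q (cong (replicate q) x≡id))) , λ y → begin
      fold y (lookup x) q                     ≡⟨ lookup-composition-replicate q x y ⟨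
      lookup (composition (replicate q x)) y  ≡⟨ cong (λ t → lookup (composition t) y) t≡x^q ⟨
      lookup (composition (x ∷ xs)) y         ≡⟨ cong (λ t → lookup t y) t-composition ⟩
      lookup idTable y                        ≡⟨ lookup-id y ⟩
      y                                       ∎
    where
    t≡x^q : x ∷ xs ≡ replicate q x
    t≡x^q = trans (rotate-fixed⇒replicate x xs (All.lookup t-fixed (∈-allFin (fromℕ< {1} {q} (s≤s (s≤s z≤n))))))
                  (cong (λ k → replicate k x) |t|≡q)
    open ≡-Reasoning

-- Elements of order prime to the modulus

module Reduction {n : ℕ} (m p : ℕ) .{{_ : NonZero m}} .{{_ : NonZero p}} (S : List (Permutation′ n)) (p∣m : p ∣ m) where

  private
    module M = Game m S
    module P = Game p S
    module ℤm = AbelianGroup (ℤₘ.abelianGroup m)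
    module ℤp = AbelianGroup (ℤₘ.abelianGroup p)
    module ℤp′ = AbelianGroupProperties (ℤₘ.abelianGroup p)

  π : ℤ_ m → ℤ_ p
  π a = toℕ a mod p

  π-0 : π ℤm.ε ≡ ℤp.ε
  π-0 = cong (_mod p) (ℤₘ.toℕ-0ₘ m)

  π-∙ : ∀ a b → π (a ℤm.∙ b) ≡ π a ℤp.∙ π b
  π-∙ a b = ℤₘ.mod-cong p (begin
    toℕ ((toℕ a + toℕ b) mod m) % p    ≡⟨ cong (_% p) (ℤₘ.toℕ-mod m (toℕ a + toℕ b)) ⟩
    (toℕ a + toℕ b) % m % p            ≡⟨ m∣n⇒o%n%m≡o%m p m (toℕ a + toℕ b) p∣m ⟩
    (toℕ a + toℕ b) % p                ≡⟨ %-distribˡ-+ (toℕ a) (toℕ b) p ⟩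
    (toℕ a % p + toℕ b % p) % p        ≡⟨ cong₂ (λ x y → (x + y) % p) (ℤₘ.toℕ-mod p _) (ℤₘ.toℕ-mod p _) ⟨
    (toℕ (π a) + toℕ (π b)) % p        ∎)
    where open ≡-Reasoning

  π-⁻¹ : ∀ a → π (a ℤm.⁻¹) ≡ π a ℤp.⁻¹
  π-⁻¹ a = ℤp′.inverseʳ-unique (π a) (π (a ℤm.⁻¹))
    (trans (sym (π-∙ a (a ℤm.⁻¹))) (trans (cong π (ℤm.inverseʳ a)) π-0))

  π-- : ∀ a b → π (a ℤm.- b) ≡ π a ℤp.- π b
  π-- a b = trans (π-∙ a (b ℤm.⁻¹)) (cong (π a ℤp.∙_) (π-⁻¹ b))

  Layer-π : ∀ j v → M.Layer j v → P.Layer j (π ∘ v)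
  Layer-π zero    v v≈ε i = trans (cong π (v≈ε i)) π-0
  Layer-π (suc j) v v∈ = All.map (λ {s} d∈ → P.Layer-resp j (λ i → π-- (v (s ⟨$⟩ʳ i)) (v i)) (Layer-π j _ d∈)) v∈

  π-section : ∀ c → π (toℕ c mod m) ≡ c
  π-section c = trans (cong (_mod p) (trans (ℤₘ.toℕ-mod m (toℕ c)) (m<n⇒m%n≡m (<-≤-trans (toℕ<n c) (∣⇒≤ p∣m)))))
                      (ℤₘ.toℕ-mod-toℕ p c)

  nilpotent-mod : M.Nilpotent → P.Nilpotent
  nilpotent-mod (N , all∈) = N , λ u → P.Layer-resp N (π-section ∘ u) (Layer-π N _ (all∈ (λ i → toℕ (u i) mod m)))

module Necessity {n : ℕ} (p : ℕ) .{{_ : NonZero p}} (S : List (Permutation′ n)) (pp : Prime p)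
  {r : ℕ} (pr : Prime r) (r≢p : r ≢ p)
  (g : Table n) (gw : InGen S g) (g^r≗id : ∀ x → fold x (lookup g) r ≡ x) where

  open Game p S
  open LayerGenerated p S
  open ℤₘ p using (_×ₘ_; toℕ-×ₘ; toℕ-0ₘ; toℕ-mod)
  private
    module ℤp = AbelianGroup (ℤₘ.abelianGroup p)
    module ℤp′ = AbelianGroupProperties (ℤₘ.abelianGroup p)

  D : Config n p → Config n p
  D u = (u ◁ᵗ g) - u

  r×≡ε⇒≡ε : ∀ c → r ×ₘ c ≡ ℤp.ε → c ≡ ℤp.ε
  r×≡ε⇒≡ε c r×c≡ε with euclidsLemma r (toℕ c) pp
    (m%n≡0⇒n∣m (r * toℕ c) p (trans (sym (toℕ-×ₘ r c)) (trans (cong toℕ r×c≡ε) toℕ-0ₘ)))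
  ... | inj₁ p∣r = contradiction (sym (prime∣prime⇒≡ pp pr p∣r)) r≢p
  ... | inj₂ p∣c = toℕ-injective (trans (trans (sym (m<n⇒m%n≡m (toℕ<n c))) (n∣m⇒m%n≡0 (toℕ c) p p∣c)) (sym toℕ-0ₘ))

  -- if D u is g-invariant, then u grows by D u along each g-orbit and so r ×ₘ D u = 0
  D²≈ε⇒D≈ε : ∀ u → D (D u) ≈ ε → D u ≈ ε
  D²≈ε⇒D≈ε u D²u≈ε x = r×≡ε⇒≡ε (D u x) (ℤp′.∙-cancelʳ (u x) (r ×ₘ D u x) ℤp.ε (begin
    r ×ₘ D u x ℤp.∙ u x       ≡⟨ along-orbit r ⟨
    u (fold x (lookup g) r)   ≡⟨ cong u (g^r≗id x) ⟩
    u x                       ≡⟨ ℤp.identityˡ (u x) ⟨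
    ℤp.ε ℤp.∙ u x             ∎))
    where
    open ≡-Reasoning
    D-invariant : ∀ y → D u (lookup g y) ≡ D u y
    D-invariant y = ℤp′.x∙y⁻¹≈ε⇒x≈y _ _ (D²u≈ε y)
    D-orbit : ∀ k → D u (fold x (lookup g) k) ≡ D u x
    D-orbit zero    = refl
    D-orbit (suc k) = trans (D-invariant _) (D-orbit k)
    along-orbit : ∀ k → u (fold x (lookup g) k) ≡ k ×ₘ D u x ℤp.∙ u x
    along-orbit zero    = sym (ℤp.identityˡ (u x))
    along-orbit (suc k) = begin
      u (lookup g y)                     ≡⟨ ℤp′.//-rightDividesˡ (u y) (u (lookup g y)) ⟨
      D u y ℤp.∙ u y                     ≡⟨ cong₂ ℤp._∙_ (D-orbit k) (along-orbit k) ⟩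
      D u x ℤp.∙ (k ×ₘ D u x ℤp.∙ u x)   ≡⟨ ℤp.assoc (D u x) (k ×ₘ D u x) (u x) ⟨
      suc k ×ₘ D u x ℤp.∙ u x            ∎
      where y = fold x (lookup g) k

  Layer-D⇒D≈ε : ∀ j u → Layer j (D u) → D u ≈ ε
  Layer-D⇒D≈ε zero    u Du∈ = Du∈
  Layer-D⇒D≈ε (suc j) u Du∈ = D²≈ε⇒D≈ε u (Layer-D⇒D≈ε j (D u) (◁ᵗ-∼ j gw {D u} Du∈))

  ¬nilpotent : ∀ x₀ → lookup g x₀ ≢ x₀ → ¬ Nilpotent
  ¬nilpotent x₀ gx₀≢x₀ (N , all∈) = 1≢0 (begin
    1 mod p             ≡⟨ δ-x₀ ⟨
    δ x₀                ≡⟨ ℤp′.x∙y⁻¹≈ε⇒x≈y _ _ (Layer-D⇒D≈ε N δ (all∈ (D δ)) x₀) ⟨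
    δ (lookup g x₀)     ≡⟨ δ-gx₀ ⟩
    ℤp.ε                ∎)
    where
    open ≡-Reasoning
    δ : Config n p
    δ y with y Fin.≟ x₀
    ... | yes _ = 1 mod p
    ... | no  _ = ℤp.ε
    δ-x₀ : δ x₀ ≡ 1 mod p
    δ-x₀ with x₀ Fin.≟ x₀
    ... | yes _   = refl
    ... | no x₀≢x₀ = contradiction refl x₀≢x₀
    δ-gx₀ : δ (lookup g x₀) ≡ ℤp.ε
    δ-gx₀ with lookup g x₀ Fin.≟ x₀
    ... | yes gx₀≡x₀ = contradiction gx₀≡x₀ gx₀≢x₀
    ... | no _       = refl
    1≢0 : 1 mod p ≢ ℤp.ε
    1≢0 1≡0 = contradiction (trans (sym (m<n⇒m%n≡m (nonTrivial⇒n>1 p {{prime⇒nonTrivial pp}})))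
                                   (trans (sym (toℕ-mod 1)) (trans (cong toℕ 1≡0) toℕ-0ₘ))) λ ()

≢idTable⇒∃moved : ∀ {n} (g : Table n) → g ≢ idTable → ∃ λ x → lookup g x ≢ x
≢idTable⇒∃moved g g≢id with Fin.all? (λ x → lookup g x Fin.≟ x)
... | yes g≗id = contradiction (lookup-ext λ x → trans (g≗id x) (sym (lookup-id x))) g≢id
... | no ¬g≗id = ¬∀⟶∃¬ _ _ (λ x → lookup g x Fin.≟ x) ¬g≗id

module _ {n : ℕ} (m : ℕ) .{{_ : NonZero m}} (S : List (Permutation′ n))
  (G : List (Table n)) (G! : Unique G) (G⇔ : ∀ v → (v ∈ G) ⇔ InGen S v) where

  open Game m S

  trivialGroup⇒nilpotent : length G ≡ 1 → Nilpotent
  trivialGroup⇒nilpotent |G|≡1 = 1 , λ v → All.tabulate λ {s} s∈ →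
    ≈-trans (//-cong₂ (λ i → cong v (s-trivial s∈ i)) (≈-refl {v})) (inverseʳ v)
    where
    s-trivial : ∀ {s} → s ∈ S → ∀ i → s ⟨$⟩ʳ i ≡ i
    s-trivial {s} s∈ i = trans (sym (lookup∘tabulate (s ⟨$⟩ʳ_) i))
      (trans (cong (λ t → lookup t i) (∈-length≡1⇒≡ |G|≡1 (InGen⇒∈ G⇔ (InGen-table S s∈)) (InGen⇒∈ G⇔ gen-id)))
             (lookup-id i))

  trivialModulus⇒nilpotent : m ≡ 1 → Nilpotent
  trivialModulus⇒nilpotent refl = 0 , λ v i → toℕ-injective (trans (n<1⇒n≡0 (toℕ<n (v i))) (sym (ℤₘ.toℕ-0ₘ 1)))

  module _ {k : ℕ} (|G|≡k : length G ≡ k) where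

    winCondition⇒nilpotent : WinCondition k m → Nilpotent
    winCondition⇒nilpotent (inj₁ k≡1)        = trivialGroup⇒nilpotent (trans |G|≡k k≡1)
    winCondition⇒nilpotent (inj₂ (inj₁ m≡1)) = trivialModulus⇒nilpotent m≡1
    winCondition⇒nilpotent (inj₂ (inj₂ (p , a , b , pp , _ , _ , k≡p^a , m≡p^b))) =
      Sufficiency.nilpotent m S G G! G⇔ {a = a} {b} pp (trans |G|≡k k≡p^a) m≡p^b

    prime-divisors-agree : Nilpotent → ∀ {p r} → Prime p → p ∣ m → Prime r → r ∣ k → r ≡ p
    prime-divisors-agree nil {p} {r} pp p∣m pr r∣k with r ℕ.≟ p
    ... | yes r≡p = r≡p
    ... | no  r≢p = ⊥-elim (prime≢p∤order pr r≢p (subst (r ∣_) (sym |G|≡k) r∣k))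
      where
      instance
        p≢0 : NonZero p
        p≢0 = prime⇒nonZero pp
      prime≢p∤order : ∀ {r} → Prime r → r ≢ p → r ∣ length G → ⊥
      prime≢p∤order {zero}          p0 _ _ = ≢-nonZero⁻¹ 0 {{prime⇒nonZero p0}} refl
      prime≢p∤order {suc zero}      p1 _ _ = ¬prime[1] p1
      prime≢p∤order {suc (suc r″)} pr r≢p r∣|G| with Cauchy.cauchy S G G! G⇔ pr r∣|G|
      ... | g , g∈ , g≢id , g^r≗id with ≢idTable⇒∃moved g g≢id
      ...   | x₀ , gx₀≢x₀ =
        Necessity.¬nilpotent p S pp pr r≢p g (∈⇒InGen G⇔ g∈) g^r≗id x₀ gx₀≢x₀ (Reduction.nilpotent-mod m p S p∣m nil)

    nilpotent⇒winCondition : Nilpotent → WinCondition k m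
    nilpotent⇒winCondition nil = samePrime⇒winCondition k≢0 (≢-nonZero⁻¹ m) (prime-divisors-agree nil)
      where
      k≢0 : k ≢ 0
      k≢0 k≡0 = ≢-nonZero⁻¹ (length G) {{∈⇒nonZero-length (InGen⇒∈ G⇔ gen-id)}} (trans |G|≡k k≡0)

theorem1p2 : (n m : ℕ) → 1 ≤ n → .{{_ : NonZero m}} →
    (S : List (Permutation′ n)) → (∃ λ e → e ∈ S × IsIdentity e) →
    (k : ℕ) → GroupOrder S k →
    CanWin S m ⇔ WinCondition k m
theorem1p2 n m _ S (e , e∈S , e-id) k (G , G! , |G|≡k , G⇔) = mk⇔
  (λ canWin → nilpotent⇒winCondition m S G G! G⇔ |G|≡k (canWin⇒nilpotent e∈S e-id canWin))
  (λ win → nilpotent⇒canWin (winCondition⇒nilpotent m S G G! G⇔ |G|≡k win))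
  where open Game m S
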